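{- Let $\mathbf{k}$ be a commutative ring, let $\beta,\alpha\in\mathbf{k}$, and let $n$ be a positive integer. Let $\mathcal{X}=\mathbf{k}[x_{i,j}\mid 1\le i<j\le n]$ and let $\mathcal{J}\subseteq\mathcal{X}$ be the ideal generated by all elements $x_{i,j}x_{j,k}-x_{i,k}(x_{i,j}+x_{j,k}+\beta)-\alpha$ with $1\le i<j<k\le n$. Then the images of the forkless monomials in the quotient ring $\mathcal{X}/\mathcal{J}$ form a basis of the $\mathbf{k}$-module $\mathcal{X}/\mathcal{J}$.
   Context: A monomial (element of the free abelian monoid on the $x_{i,j}$, without coefficient) $\mathfrak{m}$ is forkless if there is no triple $(i,j,k)$ with $1\le i<j<k\le n$ such that $x_{i,j}x_{i,k}$ divides $\mathfrak{m}$. -}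

module Defs where

open import Level using (Level; _⊔_)
open import Algebra.Bundles using (CommutativeRing)
open import Data.Nat as ℕ using (ℕ)
open import Data.Fin as Fin using (Fin; _<_)
open import Data.Fin.Properties using (all?; _<?_) renaming (_≟_ to _≟ᶠ_)
open import Data.Bool using (if_then_else_; _∧_)
open import Data.List using (List; []; _∷_; _++_; map; concatMap; foldr)
open import Data.List.Relation.Unary.All using (All)
open import Data.Product using (Σ; ∃; _×_; _,_; proj₁; proj₂)
open import Relation.Binary.PropositionalEquality using (_≡_)
open import Relation.Nullary using (Dec; does; ¬_)
open import Relation.Nullary.Decidable using (_→-dec_)

-- The polynomial ring X = k[x_{i,j} | 1 ≤ i < j ≤ n] over a commutative ring k,
-- with variables indexed by pairs (i , j) of Fin n with i < j (0-based).
module Poly {c ℓ : Level} (R : CommutativeRing c ℓ) (n : ℕ) where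
  open CommutativeRing R

  -- A monomial: exponent of x_{i,j}.  Only the entries with i < j are
  -- meaningful; monomials are compared on those entries only.
  Mon : Set
  Mon = Fin n → Fin n → ℕ

  _≈ₘ_ : Mon → Mon → Set
  m ≈ₘ m' = ∀ i j → i < j → m i j ≡ m' i j

  _≈ₘ?_ : (m m' : Mon) → Dec (m ≈ₘ m')
  m ≈ₘ? m' = all? λ i → all? λ j → (i <? j) →-dec (m i j ℕ.≟ m' i j)

  1ₘ : Mon
  1ₘ _ _ = 0

  _*ₘ_ : Mon → Mon → Mon
  (m *ₘ m') i j = m i j ℕ.+ m' i j

  varₘ : Fin n → Fin n → Mon
  varₘ i j a b = if does (a ≟ᶠ i) ∧ does (b ≟ᶠ j) then 1 else 0

  Pol : Set c
  Pol = List (Carrier × Mon)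

  coeff : Pol → Mon → Carrier
  coeff [] m = 0#
  coeff ((a , m') ∷ p) m = if does (m' ≈ₘ? m) then a + coeff p m else coeff p m

  _≈ₚ_ : Pol → Pol → Set ℓ
  p ≈ₚ q = ∀ m → coeff p m ≈ coeff q m

  0ₚ : Pol
  0ₚ = []

  const : Carrier → Pol
  const a = (a , 1ₘ) ∷ []

  var : Fin n → Fin n → Pol
  var i j = (1# , varₘ i j) ∷ []

  _+ₚ_ : Pol → Pol → Pol
  p +ₚ q = p ++ q

  -ₚ_ : Pol → Pol
  -ₚ p = map (λ { (a , m) → (- a , m) }) p

  _-ₚ_ : Pol → Pol → Pol
  p -ₚ q = p +ₚ (-ₚ q)

  _*ₚ_ : Pol → Pol → Pol
  p *ₚ q = concatMap (λ { (a , m) → map (λ { (b , m') → (a * b , m *ₘ m') }) q }) p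

  sumₚ : List Pol → Pol
  sumₚ = foldr _+ₚ_ 0ₚ

  monₚ : Mon → Pol
  monₚ m = (1# , m) ∷ []

  Triple : Set
  Triple = Σ (Fin n × Fin n × Fin n) λ { (i , j , k) → i < j × j < k }

  gen : Carrier → Carrier → Triple → Pol
  gen β α ((i , j , k) , _) =
    ((var i j *ₚ var j k) -ₚ (var i k *ₚ ((var i j +ₚ var j k) +ₚ const β))) -ₚ const α

  InJ : Carrier → Carrier → Pol → Set (c ⊔ ℓ)
  InJ β α p = ∃ λ (fs : List (Pol × Triple)) →
    p ≈ₚ sumₚ (map (λ { (f , t) → f *ₚ gen β α t }) fs)

  _≡[_,_]_ : Pol → Carrier → Carrier → Pol → Set (c ⊔ ℓ)
  p ≡[ β , α ] q = InJ β α (p -ₚ q)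

  Forkless : Mon → Set
  Forkless m = ¬ (∃ λ i → ∃ λ j → ∃ λ k →
    i < j × j < k × 1 ℕ.≤ m i j × 1 ℕ.≤ m i k)

  lincomb : List (Carrier × Mon) → Pol
  lincomb ts = sumₚ (map (λ { (a , m) → const a *ₚ monₚ m }) ts)

  ForklessSpan : Carrier → Carrier → Set (c ⊔ ℓ)
  ForklessSpan β α = ∀ (p : Pol) → ∃ λ (ts : List (Carrier × Mon)) →
    All (λ t → Forkless (proj₂ t)) ts × (p ≡[ β , α ] lincomb ts)

  ForklessIndependent : Carrier → Carrier → Set (c ⊔ ℓ)
  ForklessIndependent β α = ∀ (ts : List (Carrier × Mon)) →
    All (λ t → Forkless (proj₂ t)) ts → InJ β α (lincomb ts) →
    ∀ m → coeff ts m ≈ 0#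

  ForklessBasis : Carrier → Carrier → Set (c ⊔ ℓ)
  ForklessBasis β α = ForklessSpan β α × ForklessIndependent β α

module Submission where

-- Read each generator, for i < j < k, as the rewriting rule
--   x_ik x_ij → x_ij x_jk − x_ik x_jk − β x_ik − α.
-- The left-hand sides are exactly the forks, and giving x_ab the weight n − a makes every rule
-- strictly lower the weight, so rewriting terminates in forkless monomials: these span X/J.
-- For independence it suffices that the resulting normal form does not depend on the choices made,
-- for then it extends to a linear map that vanishes on J and fixes forkless monomials.
-- By induction on the weight this reduces to joining the two reductions of a monomial with two
-- forks (diamond lemma). Reductions at disjoint forks commute; the only overlaps are
-- x_ij x_ik x_il with i < j < k < l, whose three reductions are expanded down to forkless
-- monomials in the six variables x_ij, …, x_kl and agree.

open import Defs
open import Level using (Level)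
open import Algebra.Bundles using (CommutativeRing; CommutativeMonoid)
open import Data.Nat as ℕ using (ℕ; zero; suc; z≤n; s≤s; _≤_)
import Data.Nat.Properties as ℕP
open import Data.Nat.Tactic.RingSolver using (solve-∀)
open import Data.Integer as ℤ using (ℤ; +_; -[1+_])
import Data.Integer.Properties as ℤP
open import Data.Sign as Sign using (Sign)
open import Data.Fin as Fin using (Fin; toℕ)
import Data.Fin.Properties as FinP
open import Data.Bool using (true; false; T; if_then_else_; _∧_)
open import Data.Bool.Properties using (T-∧)
open import Data.Maybe using (Maybe; just; nothing)
open import Data.List as List using (List; []; _∷_; _++_; map; concatMap; filter; length)
import Data.List.Properties as ListP
open import Data.List.Relation.Unary.All as All using (All; []; _∷_)
import Data.List.Relation.Unary.All.Properties as AllP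
open import Data.Product using (∃; _×_; _,_; proj₁; proj₂)
open import Data.Sum using (_⊎_; inj₁; inj₂; swap)
open import Data.Empty using (⊥-elim)
open import Function using (_∘_; Equivalence)
open import Relation.Binary.PropositionalEquality as P using (_≡_; _≢_)
open import Relation.Nullary using (Dec; yes; no; does; ¬_; ¬?)
open import Relation.Nullary.Decidable using (_×-dec_)
open import Relation.Binary.Definitions using (tri<; tri≈; tri>)
open import Algebra.Solver.Ring.AlmostCommutativeRing using (fromCommutativeRing; _-Raw-AlmostCommutative⟶_)

module IntegerCoefficientSolver {c ℓ} (R : CommutativeRing c ℓ) where
  open CommutativeRing R
  open import Algebra.Properties.Ring ring using (-‿involutive; -0#≈0#; -‿distribˡ-*; -‿distribʳ-*; -‿+-comm)
  open import Algebra.Properties.CommutativeSemigroup +-commutativeSemigroup using (interchange)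
  open import Algebra.Properties.Monoid.Mult.TCOptimised +-monoid using (×-homo-+) renaming (_×_ to _×ₙ_)
  open import Algebra.Properties.Semiring.Mult.TCOptimised semiring using (×1-homo-*)
  open import Relation.Binary.Reasoning.Setoid setoid

  fromℤ : ℤ → Carrier
  fromℤ (+ n) = n ×ₙ 1#
  fromℤ -[1+ n ] = - (suc n ×ₙ 1#)

  private
    signed : Sign → Carrier → Carrier
    signed Sign.+ x = x
    signed Sign.- x = - x

    signed-cong : ∀ s {x y} → x ≈ y → signed s x ≈ signed s y
    signed-cong Sign.+ x≈y = x≈y
    signed-cong Sign.- x≈y = -‿cong x≈y

    signed-* : ∀ s t x y → signed (s Sign.* t) (x * y) ≈ signed s x * signed t y
    signed-* Sign.+ Sign.+ x y = refl
    signed-* Sign.+ Sign.- x y = -‿distribʳ-* x y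
    signed-* Sign.- Sign.+ x y = -‿distribˡ-* x y
    signed-* Sign.- Sign.- x y = begin
      x * y         ≈⟨ -‿involutive _ ⟨
      - - (x * y)   ≈⟨ -‿cong (-‿distribˡ-* x y) ⟩
      - (- x * y)   ≈⟨ -‿distribʳ-* (- x) y ⟩
      - x * - y     ∎

    fromℤ-◃ : ∀ s k → fromℤ (s ℤ.◃ k) ≈ signed s (k ×ₙ 1#)
    fromℤ-◃ Sign.+ zero = refl
    fromℤ-◃ Sign.- zero = sym -0#≈0#
    fromℤ-◃ Sign.+ (suc k) = refl
    fromℤ-◃ Sign.- (suc k) = refl

    fromℤ-signAbs : ∀ i → fromℤ i ≈ signed (ℤ.sign i) (ℤ.∣ i ∣ ×ₙ 1#)
    fromℤ-signAbs (+ n) = refl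
    fromℤ-signAbs -[1+ n ] = refl

    fromℤ-⊖ : ∀ m n → fromℤ (m ℤ.⊖ n) ≈ m ×ₙ 1# - n ×ₙ 1#
    fromℤ-⊖ m zero rewrite ℤP.⊖-≥ (z≤n {m}) = sym (trans (+-congˡ -0#≈0#) (+-identityʳ _))
    fromℤ-⊖ zero (suc n) = sym (+-identityˡ _)
    fromℤ-⊖ (suc m) (suc n) rewrite ℤP.[1+m]⊖[1+n]≡m⊖n m n = begin
      fromℤ (m ℤ.⊖ n)                    ≈⟨ fromℤ-⊖ m n ⟩
      m ×ₙ 1# - n ×ₙ 1#                    ≈⟨ +-identityˡ _ ⟨
      0# + (m ×ₙ 1# - n ×ₙ 1#)             ≈⟨ +-congʳ (-‿inverseʳ 1#) ⟨
      (1# - 1#) + (m ×ₙ 1# - n ×ₙ 1#)      ≈⟨ interchange 1# (- 1#) (m ×ₙ 1#) (- (n ×ₙ 1#)) ⟩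
      (1# + m ×ₙ 1#) + (- 1# - n ×ₙ 1#)
        ≈⟨ +-cong (×-homo-+ 1# 1 m) (trans (-‿cong (×-homo-+ 1# 1 n)) (sym (-‿+-comm 1# (n ×ₙ 1#)))) ⟨
      suc m ×ₙ 1# - suc n ×ₙ 1#            ∎

    +-homo : ∀ i j → fromℤ (i ℤ.+ j) ≈ fromℤ i + fromℤ j
    +-homo -[1+ m ] -[1+ n ] = begin
      - (suc (suc m ℕ.+ n) ×ₙ 1#)        ≡⟨ P.cong (λ k → - (suc k ×ₙ 1#)) (ℕP.+-suc m n) ⟨
      - ((suc m ℕ.+ suc n) ×ₙ 1#)        ≈⟨ -‿cong (×-homo-+ 1# (suc m) (suc n)) ⟩
      - (suc m ×ₙ 1# + suc n ×ₙ 1#)       ≈⟨ -‿+-comm _ _ ⟨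
      - (suc m ×ₙ 1#) + - (suc n ×ₙ 1#)   ∎
    +-homo -[1+ m ] (+ n) = trans (fromℤ-⊖ n (suc m)) (+-comm _ _)
    +-homo (+ m) -[1+ n ] = fromℤ-⊖ m (suc n)
    +-homo (+ m) (+ n) = ×-homo-+ 1# m n

    *-homo : ∀ i j → fromℤ (i ℤ.* j) ≈ fromℤ i * fromℤ j
    *-homo i j = begin
      fromℤ (s ℤ.◃ ℤ.∣ i ∣ ℕ.* ℤ.∣ j ∣)                            ≈⟨ fromℤ-◃ s (ℤ.∣ i ∣ ℕ.* ℤ.∣ j ∣) ⟩
      signed s ((ℤ.∣ i ∣ ℕ.* ℤ.∣ j ∣) ×ₙ 1#)                         ≈⟨ signed-cong s (×1-homo-* ℤ.∣ i ∣ ℤ.∣ j ∣) ⟩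
      signed s (ℤ.∣ i ∣ ×ₙ 1# * ℤ.∣ j ∣ ×ₙ 1#)                        ≈⟨ signed-* (ℤ.sign i) (ℤ.sign j) _ _ ⟩
      signed (ℤ.sign i) (ℤ.∣ i ∣ ×ₙ 1#) * signed (ℤ.sign j) (ℤ.∣ j ∣ ×ₙ 1#) ≈⟨ *-cong (fromℤ-signAbs i) (fromℤ-signAbs j) ⟨
      fromℤ i * fromℤ j                                             ∎
      where s = ℤ.sign i Sign.* ℤ.sign j

    -‿homo : ∀ i → fromℤ (ℤ.- i) ≈ - fromℤ i
    -‿homo (+ zero) = sym -0#≈0#
    -‿homo (+ suc n) = refl
    -‿homo -[1+ n ] = sym (-‿involutive _)

    morphism : ℤ.+-*-rawRing -Raw-AlmostCommutative⟶ fromCommutativeRing R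
    morphism = record
      { ⟦_⟧ = fromℤ ; +-homo = +-homo ; *-homo = *-homo ; -‿homo = -‿homo
      ; 0-homo = refl ; 1-homo = refl }

    fromℤ-≟ : ∀ i j → Maybe (fromℤ i ≈ fromℤ j)
    fromℤ-≟ i j with i ℤ.≟ j
    ... | yes P.refl = just refl
    ... | no _ = nothing

  open import Algebra.Solver.Ring ℤ.+-*-rawRing (fromCommutativeRing R) morphism fromℤ-≟ public
    using (solve; _:=_; _:+_; _:*_; :-_; con)

module Pairing {c ℓ} (R : CommutativeRing c ℓ) where
  open CommutativeRing R
  open import Algebra.Properties.CommutativeSemigroup +-commutativeSemigroup using (interchange)
  open import Algebra.Properties.CommutativeSemigroup *-commutativeSemigroup using (x∙yz≈y∙xz)
  open import Algebra.Properties.Ring ring using (-0#≈0#; -‿distribʳ-*; -‿+-comm)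
  open import Relation.Binary.Reasoning.Setoid setoid

  Combination : Set → Set c
  Combination M = List (Carrier × M)

  private
    variable
      M M′ : Set

  ⟨_∣_⟩ : Combination M → (M → Carrier) → Carrier
  ⟨ [] ∣ φ ⟩ = 0#
  ⟨ (a , m) ∷ p ∣ φ ⟩ = a * φ m + ⟨ p ∣ φ ⟩

  scale : Carrier → Combination M → Combination M
  scale a = map λ t → (a * proj₁ t , proj₂ t)

  bind : (M → Combination M′) → Combination M → Combination M′
  bind F = concatMap λ t → scale (proj₁ t) (F (proj₂ t))

  pairing-++ : ∀ (p q : Combination M) φ → ⟨ p ++ q ∣ φ ⟩ ≈ ⟨ p ∣ φ ⟩ + ⟨ q ∣ φ ⟩
  pairing-++ [] q φ = sym (+-identityˡ _)
  pairing-++ ((a , m) ∷ p) q φ = trans (+-congˡ (pairing-++ p q φ)) (sym (+-assoc _ _ _))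

  pairing-congᴬ : ∀ {p : Combination M} {φ ψ} → All (λ t → φ (proj₂ t) ≈ ψ (proj₂ t)) p → ⟨ p ∣ φ ⟩ ≈ ⟨ p ∣ ψ ⟩
  pairing-congᴬ [] = refl
  pairing-congᴬ (φ≈ψ ∷ φ≈ψs) = +-cong (*-congˡ φ≈ψ) (pairing-congᴬ φ≈ψs)

  pairing-cong : ∀ (p : Combination M) {φ ψ} → (∀ m → φ m ≈ ψ m) → ⟨ p ∣ φ ⟩ ≈ ⟨ p ∣ ψ ⟩
  pairing-cong [] φ≈ψ = refl
  pairing-cong ((a , m) ∷ p) φ≈ψ = +-cong (*-congˡ (φ≈ψ m)) (pairing-cong p φ≈ψ)

  pairing-0 : ∀ (p : Combination M) → ⟨ p ∣ (λ _ → 0#) ⟩ ≈ 0#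
  pairing-0 [] = refl
  pairing-0 ((a , m) ∷ p) = trans (+-cong (zeroʳ a) (pairing-0 p)) (+-identityʳ 0#)

  pairing-+ : ∀ (p : Combination M) φ ψ → ⟨ p ∣ (λ m → φ m + ψ m) ⟩ ≈ ⟨ p ∣ φ ⟩ + ⟨ p ∣ ψ ⟩
  pairing-+ [] φ ψ = sym (+-identityʳ 0#)
  pairing-+ ((a , m) ∷ p) φ ψ = begin
    a * (φ m + ψ m) + ⟨ p ∣ (λ m → φ m + ψ m) ⟩          ≈⟨ +-cong (distribˡ a _ _) (pairing-+ p φ ψ) ⟩
    (a * φ m + a * ψ m) + (⟨ p ∣ φ ⟩ + ⟨ p ∣ ψ ⟩)         ≈⟨ interchange _ _ _ _ ⟩
    (a * φ m + ⟨ p ∣ φ ⟩) + (a * ψ m + ⟨ p ∣ ψ ⟩)         ∎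

  pairing-* : ∀ (p : Combination M) a φ → ⟨ p ∣ (λ m → a * φ m) ⟩ ≈ a * ⟨ p ∣ φ ⟩
  pairing-* [] a φ = sym (zeroʳ a)
  pairing-* ((b , m) ∷ p) a φ =
    trans (+-cong (x∙yz≈y∙xz b a (φ m)) (pairing-* p a φ)) (sym (distribˡ a _ _))

  pairing-neg : ∀ (p : Combination M) φ → ⟨ p ∣ (λ m → - φ m) ⟩ ≈ - ⟨ p ∣ φ ⟩
  pairing-neg [] φ = sym -0#≈0#
  pairing-neg ((a , m) ∷ p) φ =
    trans (+-cong (sym (-‿distribʳ-* a (φ m))) (pairing-neg p φ)) (-‿+-comm _ _)

  pairing-scale : ∀ a (p : Combination M) φ → ⟨ scale a p ∣ φ ⟩ ≈ a * ⟨ p ∣ φ ⟩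
  pairing-scale a [] φ = sym (zeroʳ a)
  pairing-scale a ((b , m) ∷ p) φ =
    trans (+-cong (*-assoc a b (φ m)) (pairing-scale a p φ)) (sym (distribˡ a _ _))

  pairing-bind : ∀ (F : M → Combination M′) p φ → ⟨ bind F p ∣ φ ⟩ ≈ ⟨ p ∣ (λ m → ⟨ F m ∣ φ ⟩) ⟩
  pairing-bind F [] φ = refl
  pairing-bind F ((a , m) ∷ p) φ = begin
    ⟨ scale a (F m) ++ bind F p ∣ φ ⟩            ≈⟨ pairing-++ (scale a (F m)) (bind F p) φ ⟩
    ⟨ scale a (F m) ∣ φ ⟩ + ⟨ bind F p ∣ φ ⟩     ≈⟨ +-cong (pairing-scale a (F m) φ) (pairing-bind F p φ) ⟩
    a * ⟨ F m ∣ φ ⟩ + ⟨ p ∣ (λ m → ⟨ F m ∣ φ ⟩) ⟩ ∎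

  pairing-swap : ∀ (p : Combination M) (q : Combination M′) (g : M → M′ → Carrier) →
    ⟨ p ∣ (λ m → ⟨ q ∣ g m ⟩) ⟩ ≈ ⟨ q ∣ (λ m′ → ⟨ p ∣ (λ m → g m m′) ⟩) ⟩
  pairing-swap [] q g = sym (pairing-0 q)
  pairing-swap ((a , m) ∷ p) q g = begin
    a * ⟨ q ∣ g m ⟩ + ⟨ p ∣ (λ m → ⟨ q ∣ g m ⟩) ⟩
      ≈⟨ +-cong (pairing-* q a (g m)) (sym (pairing-swap p q g)) ⟨
    ⟨ q ∣ (λ m′ → a * g m m′) ⟩ + ⟨ q ∣ (λ m′ → ⟨ p ∣ (λ m → g m m′) ⟩) ⟩
      ≈⟨ pairing-+ q (λ m′ → a * g m m′) (λ m′ → ⟨ p ∣ (λ m → g m m′) ⟩) ⟨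
    ⟨ q ∣ (λ m′ → a * g m m′ + ⟨ p ∣ (λ m → g m m′) ⟩) ⟩ ∎

  All-bind : ∀ {P : M′ → Set} (F : M → Combination M′) p →
    All (λ e → All (P ∘ proj₂) (F (proj₂ e))) p → All (P ∘ proj₂) (bind F p)
  All-bind F [] [] = []
  All-bind F ((a , m) ∷ p) (Fm ∷ Fp) = AllP.++⁺ (AllP.map⁺ Fm) (All-bind F p Fp)

module Monomials {c ℓ} (R : CommutativeRing c ℓ) (n : ℕ) where
  open Poly R n
  open import Algebra.Properties.Semiring.Sum ℕP.+-*-semiring
    using (sum; sum-remove; sum-cong-≗; sum-replicate-zero; ∑-distrib-+; *-distribˡ-sum)
  open import Algebra.Properties.CommutativeSemigroup ℕP.*-commutativeSemigroup using (x∙yz≈y∙xz)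

  -- _≈ₘ_ wrapped in a record: unlike the underlying Π-type, it lets Agda infer the two monomials.
  record _≃_ (m m′ : Mon) : Set where
    constructor ≈ₘ⇒≃
    field ≃⇒≈ₘ : m ≈ₘ m′
  open _≃_ public

  infix 4 _≃_

  ≃-refl : ∀ {m} → m ≃ m
  ≃-refl = ≈ₘ⇒≃ λ _ _ _ → P.refl

  ≃-sym : ∀ {m m′} → m ≃ m′ → m′ ≃ m
  ≃-sym (≈ₘ⇒≃ m≈m′) = ≈ₘ⇒≃ λ a b a<b → P.sym (m≈m′ a b a<b)

  ≃-trans : ∀ {m m′ m″} → m ≃ m′ → m′ ≃ m″ → m ≃ m″
  ≃-trans (≈ₘ⇒≃ m≈m′) (≈ₘ⇒≃ m′≈m″) = ≈ₘ⇒≃ λ a b a<b → P.trans (m≈m′ a b a<b) (m′≈m″ a b a<b)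

  *ₘ-cong : ∀ {m₁ m₂ m₃ m₄} → m₁ ≃ m₂ → m₃ ≃ m₄ → m₁ *ₘ m₃ ≃ m₂ *ₘ m₄
  *ₘ-cong (≈ₘ⇒≃ m₁≈m₂) (≈ₘ⇒≃ m₃≈m₄) = ≈ₘ⇒≃ λ a b a<b → P.cong₂ ℕ._+_ (m₁≈m₂ a b a<b) (m₃≈m₄ a b a<b)

  *ₘ-assoc : ∀ m₁ m₂ m₃ → (m₁ *ₘ m₂) *ₘ m₃ ≃ m₁ *ₘ (m₂ *ₘ m₃)
  *ₘ-assoc m₁ m₂ m₃ = ≈ₘ⇒≃ λ a b _ → ℕP.+-assoc (m₁ a b) (m₂ a b) (m₃ a b)

  *ₘ-comm : ∀ m₁ m₂ → m₁ *ₘ m₂ ≃ m₂ *ₘ m₁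
  *ₘ-comm m₁ m₂ = ≈ₘ⇒≃ λ a b _ → ℕP.+-comm (m₁ a b) (m₂ a b)

  *ₘ-cancelʳ : ∀ {m₁ m₂} l → m₁ *ₘ l ≃ m₂ *ₘ l → m₁ ≃ m₂
  *ₘ-cancelʳ {m₁} {m₂} l (≈ₘ⇒≃ eq) = ≈ₘ⇒≃ λ a b a<b → ℕP.+-cancelʳ-≡ (l a b) (m₁ a b) (m₂ a b) (eq a b a<b)

  *ₘ-commutativeMonoid : CommutativeMonoid _ _
  *ₘ-commutativeMonoid = record
    { Carrier = Mon ; _≈_ = _≃_ ; _∙_ = _*ₘ_ ; ε = 1ₘ
    ; isCommutativeMonoid = record
      { isMonoid = record
        { isSemigroup = record
          { isMagma = record
            { isEquivalence = record { refl = ≃-refl ; sym = ≃-sym ; trans = ≃-trans }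
            ; ∙-cong = *ₘ-cong }
          ; assoc = *ₘ-assoc }
        ; identity = (λ m → ≃-refl) , (λ m → ≈ₘ⇒≃ λ a b _ → ℕP.+-identityʳ (m a b)) }
      ; comm = *ₘ-comm } }

  varₘ-diag : ∀ {i j a b} → a ≡ i → b ≡ j → varₘ i j a b ≡ 1
  varₘ-diag {i} {j} P.refl P.refl with i FinP.≟ i | j FinP.≟ j
  ... | yes _ | yes _ = P.refl
  ... | no i≢i | _ = ⊥-elim (i≢i P.refl)
  ... | yes _ | no j≢j = ⊥-elim (j≢j P.refl)

  varₘ-off : ∀ {i j a b} → ¬ (a ≡ i × b ≡ j) → varₘ i j a b ≡ 0
  varₘ-off {i} {j} {a} {b} ≢ with a FinP.≟ i | b FinP.≟ j
  ... | yes a≡i | yes b≡j = ⊥-elim (≢ (a≡i , b≡j))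
  ... | yes _ | no _ = P.refl
  ... | no _ | _ = P.refl

  _≤ₘ_ : Mon → Mon → Set
  l ≤ₘ m = ∀ a b → a Fin.< b → l a b ℕ.≤ m a b

  ≤ₘ-trans : ∀ {l m m′} → l ≤ₘ m → m ≤ₘ m′ → l ≤ₘ m′
  ≤ₘ-trans l≤m m≤m′ a b a<b = ℕP.≤-trans (l≤m a b a<b) (m≤m′ a b a<b)

  ≤ₘ-respˡ : ∀ {l l′ m} → l ≃ l′ → l′ ≤ₘ m → l ≤ₘ m
  ≤ₘ-respˡ (≈ₘ⇒≃ l≈l′) l′≤m a b a<b = ℕP.≤-trans (ℕP.≤-reflexive (l≈l′ a b a<b)) (l′≤m a b a<b)

  ≤ₘ-*ₘˡ : ∀ u {l m} → m ≃ l *ₘ u → l ≤ₘ m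
  ≤ₘ-*ₘˡ u {l} (≈ₘ⇒≃ m≈lu) a b a<b = ℕP.≤-trans (ℕP.m≤m+n (l a b) (u a b)) (ℕP.≤-reflexive (P.sym (m≈lu a b a<b)))

  ≤ₘ-*ₘʳ : ∀ u {l m} → m ≃ u *ₘ l → l ≤ₘ m
  ≤ₘ-*ₘʳ u {l} (≈ₘ⇒≃ m≈ul) a b a<b = ℕP.≤-trans (ℕP.m≤n+m (l a b) (u a b)) (ℕP.≤-reflexive (P.sym (m≈ul a b a<b)))

  _∸ₘ_ : Mon → Mon → Mon
  (m ∸ₘ l) a b = m a b ℕ.∸ l a b

  ∸ₘ-*ₘ : ∀ {l m} → l ≤ₘ m → m ≃ (m ∸ₘ l) *ₘ l
  ∸ₘ-*ₘ l≤m = ≈ₘ⇒≃ λ a b a<b → P.sym (ℕP.m∸n+n≡m (l≤m a b a<b))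

  varₘ-≤ₘ : ∀ {a b m} → 1 ℕ.≤ m a b → varₘ a b ≤ₘ m
  varₘ-≤ₘ {a} {b} {m} 1≤m x y _ with (x FinP.≟ a) ×-dec (y FinP.≟ b)
  ... | yes (P.refl , P.refl) rewrite varₘ-diag {a} {b} P.refl P.refl = 1≤m
  ... | no ≢ rewrite varₘ-off {a} {b} ≢ = z≤n

  ≤ₘ-varₘ : ∀ {a b m} → a Fin.< b → varₘ a b ≤ₘ m → 1 ℕ.≤ m a b
  ≤ₘ-varₘ {a} {b} a<b var≤m = ℕP.≤-trans (ℕP.≤-reflexive (P.sym (varₘ-diag {a} {b} P.refl P.refl))) (var≤m a b a<b)

  Disjoint : Mon → Mon → Set
  Disjoint l l′ = ∀ a b → l a b ≡ 0 ⊎ l′ a b ≡ 0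

  disjoint-sym : ∀ {l l′} → Disjoint l l′ → Disjoint l′ l
  disjoint-sym l#l′ a b = swap (l#l′ a b)

  disjoint-*ₘ : ∀ {l l₁ l₂} → Disjoint l l₁ → Disjoint l l₂ → Disjoint l (l₁ *ₘ l₂)
  disjoint-*ₘ l#l₁ l#l₂ a b with l#l₁ a b | l#l₂ a b
  ... | inj₁ l≡0 | _ = inj₁ l≡0
  ... | inj₂ _ | inj₁ l≡0 = inj₁ l≡0
  ... | inj₂ l₁≡0 | inj₂ l₂≡0 = inj₂ (P.cong₂ ℕ._+_ l₁≡0 l₂≡0)

  varₘ-disjoint : ∀ {a b a′ b′} → ¬ (a ≡ a′ × b ≡ b′) → Disjoint (varₘ a b) (varₘ a′ b′)
  varₘ-disjoint {a} {b} {a′} {b′} ≢ x y with (x FinP.≟ a) ×-dec (y FinP.≟ b)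
  ... | no ≢ab = inj₁ (varₘ-off ≢ab)
  ... | yes (P.refl , P.refl) = inj₂ (varₘ-off ≢)

  *ₘ-≤ₘ : ∀ {l₁ l₂ m} → Disjoint l₁ l₂ → l₁ ≤ₘ m → l₂ ≤ₘ m → (l₁ *ₘ l₂) ≤ₘ m
  *ₘ-≤ₘ {l₁} {l₂} l₁#l₂ l₁≤m l₂≤m a b a<b with l₁#l₂ a b
  ... | inj₁ l₁≡0 rewrite l₁≡0 = l₂≤m a b a<b
  ... | inj₂ l₂≡0 rewrite l₂≡0 | ℕP.+-identityʳ (l₁ a b) = l₁≤m a b a<b

  _^ₘ_ : Mon → ℕ → Mon
  (m ^ₘ k) a b = k ℕ.* m a b

  weight : Fin n → Fin n → ℕ
  weight a b with a FinP.<? b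
  ... | yes _ = n ℕ.∸ toℕ a
  ... | no _ = 0

  W : Mon → ℕ
  W m = sum λ a → sum λ b → weight a b ℕ.* m a b

  private
    sum-point : ∀ {k} (f : Fin k → ℕ) y → (∀ x → x ≢ y → f x ≡ 0) → sum f ≡ f y
    sum-point {suc k} f y f≡0 = begin
      sum f                               ≡⟨ sum-remove {i = y} f ⟩
      f y ℕ.+ sum (f ∘ Fin.punchIn y)     ≡⟨ P.cong (f y ℕ.+_) (sum-cong-≗ {k} {f ∘ Fin.punchIn y} {λ _ → 0}
                                               λ x → f≡0 (Fin.punchIn y x) (FinP.punchInᵢ≢i y x)) ⟩
      f y ℕ.+ sum {k} (λ _ → 0)           ≡⟨ P.cong (f y ℕ.+_) (sum-replicate-zero k) ⟩
      f y ℕ.+ 0                           ≡⟨ ℕP.+-identityʳ (f y) ⟩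
      f y                                 ∎
      where open P.≡-Reasoning

    weight-cong : ∀ {m m′} → m ≈ₘ m′ → ∀ a b → weight a b ℕ.* m a b ≡ weight a b ℕ.* m′ a b
    weight-cong m≈m′ a b with a FinP.<? b
    ... | yes a<b = P.cong ((n ℕ.∸ toℕ a) ℕ.*_) (m≈m′ a b a<b)
    ... | no _ = P.refl

  W-resp : ∀ {m m′} → m ≃ m′ → W m ≡ W m′
  W-resp (≈ₘ⇒≃ m≈m′) = sum-cong-≗ λ a → sum-cong-≗ λ b → weight-cong m≈m′ a b

  W-*ₘ : ∀ m m′ → W (m *ₘ m′) ≡ W m ℕ.+ W m′
  W-*ₘ m m′ = P.trans
    (sum-cong-≗ λ a → P.trans (sum-cong-≗ λ b → ℕP.*-distribˡ-+ (weight a b) (m a b) (m′ a b))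
                                (∑-distrib-+ (λ b → weight a b ℕ.* m a b) (λ b → weight a b ℕ.* m′ a b)))
    (∑-distrib-+ (λ a → sum λ b → weight a b ℕ.* m a b) (λ a → sum λ b → weight a b ℕ.* m′ a b))

  W-^ₘ : ∀ m k → W (m ^ₘ k) ≡ k ℕ.* W m
  W-^ₘ m k = P.sym (P.trans (*-distribˡ-sum k (λ a → sum λ b → weight a b ℕ.* m a b))
    (sum-cong-≗ λ a → P.trans (*-distribˡ-sum k (λ b → weight a b ℕ.* m a b))
                              (sum-cong-≗ λ b → x∙yz≈y∙xz k (weight a b) (m a b))))

  W-1ₘ : W 1ₘ ≡ 0
  W-1ₘ = P.trans (sum-cong-≗ λ a → P.trans (sum-cong-≗ λ b → ℕP.*-zeroʳ (weight a b)) (sum-replicate-zero n))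
                 (sum-replicate-zero n)

  W-varₘ : ∀ {i j} → i Fin.< j → W (varₘ i j) ≡ n ℕ.∸ toℕ i
  W-varₘ {i} {j} i<j = P.trans (sum-point _ i off-row) (P.trans (sum-point _ j off-column) diagonal)
    where
    off-row : ∀ a → a ≢ i → sum (λ b → weight a b ℕ.* varₘ i j a b) ≡ 0
    off-row a a≢i = P.trans
      (sum-cong-≗ λ b → P.trans (P.cong (weight a b ℕ.*_) (varₘ-off {i} {j} {a} {b} (a≢i ∘ proj₁))) (ℕP.*-zeroʳ (weight a b)))
                            (sum-replicate-zero n)
    off-column : ∀ b → b ≢ j → weight i b ℕ.* varₘ i j i b ≡ 0
    off-column b b≢j = P.trans (P.cong (weight i b ℕ.*_) (varₘ-off {i} {j} {i} {b} (b≢j ∘ proj₂))) (ℕP.*-zeroʳ (weight i b))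
    diagonal : weight i j ℕ.* varₘ i j i j ≡ n ℕ.∸ toℕ i
    diagonal rewrite varₘ-diag {i} {j} P.refl P.refl with i FinP.<? j
    ... | yes _ = ℕP.*-identityʳ _
    ... | no i≮j = ⊥-elim (i≮j i<j)

module Polynomials {c ℓ} (R : CommutativeRing c ℓ) (n : ℕ) where
  open CommutativeRing R
  open Poly R n
  open Pairing R
  open Monomials R n
  open import Algebra.Properties.Ring ring using (-0#≈0#; -‿distribˡ-*; -‿+-comm)
  open import Algebra.Properties.Group +-group using (x∙y⁻¹≈ε⇒x≈y)
  open import Algebra.Properties.CommutativeSemigroup +-commutativeSemigroup using (x∙yz≈y∙xz)
  open import Relation.Binary.Reasoning.Setoid setoid

  δ : Mon → Mon → Carrier
  δ y m = if does (m ≈ₘ? y) then 1# else 0#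

  Respects : (Mon → Carrier) → Set _
  Respects φ = ∀ {m m′} → m ≃ m′ → φ m ≈ φ m′

  private
    does-⇔ : ∀ {A B : Set} (d : Dec A) (d′ : Dec B) → (A → B) → (B → A) → does d ≡ does d′
    does-⇔ (yes _) (yes _) _ _ = P.refl
    does-⇔ (no _) (no _) _ _ = P.refl
    does-⇔ (yes a) (no ¬b) f _ = ⊥-elim (¬b (f a))
    does-⇔ (no ¬a) (yes b) _ g = ⊥-elim (¬a (g b))

    if-+ : ∀ b a x → (if b then a + x else x) ≈ a * (if b then 1# else 0#) + x
    if-+ true a x = +-congʳ (sym (*-identityʳ a))
    if-+ false a x = sym (trans (+-congʳ (zeroʳ a)) (+-identityˡ x))

  δ-resp : ∀ y → Respects (δ y)
  δ-resp y {m} {m′} m≃m′ = reflexive (P.cong (λ b → if b then 1# else 0#) (does-⇔ (m ≈ₘ? y) (m′ ≈ₘ? y)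
    (λ m≈y → ≃⇒≈ₘ (≃-trans (≃-sym m≃m′) (≈ₘ⇒≃ m≈y))) (λ m′≈y → ≃⇒≈ₘ (≃-trans m≃m′ (≈ₘ⇒≃ m′≈y)))))

  coeff≈pairing : ∀ p y → coeff p y ≈ ⟨ p ∣ δ y ⟩
  coeff≈pairing [] y = refl
  coeff≈pairing ((a , m) ∷ p) y = trans (if-+ (does (m ≈ₘ? y)) a (coeff p y)) (+-congˡ (coeff≈pairing p y))

  pairing-negₚ : ∀ p φ → ⟨ -ₚ p ∣ φ ⟩ ≈ - ⟨ p ∣ φ ⟩
  pairing-negₚ [] φ = sym -0#≈0#
  pairing-negₚ ((a , m) ∷ p) φ = trans (+-cong (sym (-‿distribˡ-* a (φ m))) (pairing-negₚ p φ)) (-‿+-comm _ _)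

  pairing--ₚ : ∀ p q φ → ⟨ p -ₚ q ∣ φ ⟩ ≈ ⟨ p ∣ φ ⟩ - ⟨ q ∣ φ ⟩
  pairing--ₚ p q φ = trans (pairing-++ p (-ₚ q) φ) (+-congˡ (pairing-negₚ q φ))

  pairing-monₚ : ∀ m φ → ⟨ monₚ m ∣ φ ⟩ ≈ φ m
  pairing-monₚ m φ = trans (+-identityʳ _) (*-identityˡ (φ m))

  private
    shift : Carrier → Mon → Pol → Pol
    shift a u = map λ t → (a * proj₁ t , u *ₘ proj₂ t)

    pairing-shift : ∀ a u q φ → ⟨ shift a u q ∣ φ ⟩ ≈ a * ⟨ q ∣ φ ∘ (u *ₘ_) ⟩
    pairing-shift a u [] φ = sym (zeroʳ a)
    pairing-shift a u ((b , m) ∷ q) φ =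
      trans (+-cong (*-assoc a b _) (pairing-shift a u q φ)) (sym (distribˡ a _ _))

  pairing-*ₚ : ∀ p q φ → ⟨ p *ₚ q ∣ φ ⟩ ≈ ⟨ p ∣ (λ u → ⟨ q ∣ φ ∘ (u *ₘ_) ⟩) ⟩
  pairing-*ₚ [] q φ = refl
  pairing-*ₚ ((a , u) ∷ p) q φ =
    trans (pairing-++ (shift a u q) (p *ₚ q) φ) (+-cong (pairing-shift a u q φ) (pairing-*ₚ p q φ))

  coeff-bind : ∀ (F : Mon → Pol) p y → coeff (bind F p) y ≈ ⟨ p ∣ (λ m → coeff (F m) y) ⟩
  coeff-bind F p y = trans (coeff≈pairing (bind F p) y)
    (trans (pairing-bind F p (δ y)) (pairing-cong p λ m → sym (coeff≈pairing (F m) y)))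

  coeff-monₚ : ∀ m y → coeff (monₚ m) y ≈ δ y m
  coeff-monₚ m y = trans (coeff≈pairing (monₚ m) y) (pairing-monₚ m (δ y))

  monₚ-resp : ∀ {m m′} → m ≃ m′ → monₚ m ≈ₚ monₚ m′
  monₚ-resp m≃m′ y = trans (coeff-monₚ _ y) (trans (δ-resp y m≃m′) (sym (coeff-monₚ _ y)))

  coeff-++ : ∀ p q y → coeff (p ++ q) y ≈ coeff p y + coeff q y
  coeff-++ p q y = trans (coeff≈pairing (p ++ q) y)
    (trans (pairing-++ p q (δ y)) (sym (+-cong (coeff≈pairing p y) (coeff≈pairing q y))))

  coeff--ₚ : ∀ p q y → coeff (p -ₚ q) y ≈ coeff p y - coeff q y
  coeff--ₚ p q y = trans (coeff≈pairing (p -ₚ q) y)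
    (trans (pairing--ₚ p q (δ y)) (sym (+-cong (coeff≈pairing p y) (-‿cong (coeff≈pairing q y)))))

  -ₚ-bind : ∀ (F : Mon → Pol) p → (p -ₚ bind F p) ≈ₚ bind (λ m → monₚ m -ₚ F m) p
  -ₚ-bind F p y = begin
    coeff (p -ₚ bind F p) y                                   ≈⟨ coeff--ₚ p (bind F p) y ⟩
    coeff p y - coeff (bind F p) y                            ≈⟨ +-cong (coeff≈pairing p y) (-‿cong (coeff-bind F p y)) ⟩
    ⟨ p ∣ δ y ⟩ - ⟨ p ∣ (λ m → coeff (F m) y) ⟩               ≈⟨ +-congˡ (pairing-neg p _) ⟨
    ⟨ p ∣ δ y ⟩ + ⟨ p ∣ (λ m → - coeff (F m) y) ⟩             ≈⟨ pairing-+ p _ _ ⟨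
    ⟨ p ∣ (λ m → δ y m - coeff (F m) y) ⟩                     ≈⟨ pairing-cong p (λ m → trans (+-congʳ (sym (coeff-monₚ m y)))
                                                                                           (sym (coeff--ₚ (monₚ m) (F m) y))) ⟩
    ⟨ p ∣ (λ m → coeff (monₚ m -ₚ F m) y) ⟩                   ≈⟨ coeff-bind (λ m → monₚ m -ₚ F m) p y ⟨
    coeff (bind (λ m → monₚ m -ₚ F m) p) y                    ∎

  pairing-lincomb : ∀ ts φ → ⟨ lincomb ts ∣ φ ⟩ ≈ ⟨ ts ∣ φ ⟩
  pairing-lincomb [] φ = refl
  pairing-lincomb ((a , m) ∷ ts) φ = +-cong (*-congʳ (*-identityʳ a)) (pairing-lincomb ts φ)

  coeff-lincomb : ∀ ts y → coeff (lincomb ts) y ≈ coeff ts y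
  coeff-lincomb ts y = trans (coeff≈pairing (lincomb ts) y) (trans (pairing-lincomb ts (δ y)) (sym (coeff≈pairing ts y)))

  sieve : Mon → Pol → Pol
  sieve y = filter λ t → ¬? (proj₂ t ≈ₘ? y)

  private
    sieve-∷ : ∀ {a m y} p → m ≈ₘ y → sieve y ((a , m) ∷ p) ≡ sieve y p
    sieve-∷ {y = y} p m≈y = ListP.filter-reject (λ t → ¬? (proj₂ t ≈ₘ? y)) (λ m≉y → m≉y m≈y)

  pairing-sieve : ∀ {φ} → Respects φ → ∀ y p → ⟨ p ∣ φ ⟩ ≈ coeff p y * φ y + ⟨ sieve y p ∣ φ ⟩
  pairing-sieve resp y [] = sym (trans (+-congʳ (zeroˡ _)) (+-identityˡ 0#))
  pairing-sieve {φ} resp y ((a , m) ∷ p) = by-cases (m ≈ₘ? y)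
    where
    by-cases : (d : Dec (m ≈ₘ y)) →
      a * φ m + ⟨ p ∣ φ ⟩ ≈ (if does d then a + coeff p y else coeff p y) * φ y + ⟨ sieve y ((a , m) ∷ p) ∣ φ ⟩
    by-cases (yes m≈y) rewrite sieve-∷ {a} p m≈y = begin
      a * φ m + ⟨ p ∣ φ ⟩                               ≈⟨ +-cong (*-congˡ (resp (≈ₘ⇒≃ m≈y))) (pairing-sieve resp y p) ⟩
      a * φ y + (coeff p y * φ y + ⟨ sieve y p ∣ φ ⟩)   ≈⟨ +-assoc _ _ _ ⟨
      (a * φ y + coeff p y * φ y) + ⟨ sieve y p ∣ φ ⟩   ≈⟨ +-congʳ (distribʳ (φ y) a (coeff p y)) ⟨
      (a + coeff p y) * φ y + ⟨ sieve y p ∣ φ ⟩         ∎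
    by-cases (no m≉y) rewrite ListP.filter-accept (λ t → ¬? (proj₂ t ≈ₘ? y)) {a , m} {p} m≉y =
      trans (+-congˡ (pairing-sieve resp y p)) (x∙yz≈y∙xz _ _ _)

  -- Induction on the length: all terms of the head monomial are removed at once.
  pairing-null : ∀ {φ} → Respects φ → ∀ p → (∀ z → coeff p z ≈ 0#) → ⟨ p ∣ φ ⟩ ≈ 0#
  pairing-null {φ} resp p = by-length (length p) p ℕP.≤-refl
    where
    by-length : ∀ k p → length p ≤ k → (∀ z → coeff p z ≈ 0#) → ⟨ p ∣ φ ⟩ ≈ 0#
    by-length _ [] _ _ = refl
    by-length (suc k) p@((a , y) ∷ p′) (s≤s |p′|≤k) p≈0 = begin
      ⟨ p ∣ φ ⟩                                  ≈⟨ pairing-sieve resp y p ⟩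
      coeff p y * φ y + ⟨ sieve y p ∣ φ ⟩
        ≈⟨ +-cong (trans (*-congʳ (p≈0 y)) (zeroˡ _)) (by-length k (sieve y p) shorter sieve≈0) ⟩
      0# + 0#                                    ≈⟨ +-identityʳ 0# ⟩
      0#                                         ∎
      where
      shorter : length (sieve y p) ≤ k
      shorter rewrite sieve-∷ {a} p′ (≃⇒≈ₘ (≃-refl {y})) = ℕP.≤-trans (ListP.length-filter _ p′) |p′|≤k
      sieve≈0 : ∀ z → coeff (sieve y p) z ≈ 0#
      sieve≈0 z = begin
        coeff (sieve y p) z                          ≈⟨ coeff≈pairing (sieve y p) z ⟩
        ⟨ sieve y p ∣ δ z ⟩                          ≈⟨ +-identityˡ _ ⟨
        0# + ⟨ sieve y p ∣ δ z ⟩                     ≈⟨ +-congʳ (trans (*-congʳ (p≈0 y)) (zeroˡ _)) ⟨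
        coeff p y * δ z y + ⟨ sieve y p ∣ δ z ⟩     ≈⟨ pairing-sieve (δ-resp z) y p ⟨
        ⟨ p ∣ δ z ⟩                                  ≈⟨ coeff≈pairing p z ⟨
        coeff p z                                    ≈⟨ p≈0 z ⟩
        0#                                           ∎

  pairing-resp : ∀ {φ} → Respects φ → ∀ {p q} → p ≈ₚ q → ⟨ p ∣ φ ⟩ ≈ ⟨ q ∣ φ ⟩
  pairing-resp {φ} resp {p} {q} p≈q = x∙y⁻¹≈ε⇒x≈y _ _ (begin
    ⟨ p ∣ φ ⟩ - ⟨ q ∣ φ ⟩     ≈⟨ pairing--ₚ p q φ ⟨
    ⟨ p -ₚ q ∣ φ ⟩           ≈⟨ pairing-null resp (p -ₚ q) p-q≈0 ⟩
    0#                       ∎)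
    where
    p-q≈0 : ∀ z → coeff (p -ₚ q) z ≈ 0#
    p-q≈0 z = begin
      coeff (p -ₚ q) z                  ≈⟨ coeff≈pairing (p -ₚ q) z ⟩
      ⟨ p -ₚ q ∣ δ z ⟩                  ≈⟨ pairing--ₚ p q (δ z) ⟩
      ⟨ p ∣ δ z ⟩ - ⟨ q ∣ δ z ⟩         ≈⟨ +-cong (coeff≈pairing p z) (-‿cong (coeff≈pairing q z)) ⟨
      coeff p z - coeff q z             ≈⟨ +-congʳ (p≈q z) ⟩
      coeff q z - coeff q z             ≈⟨ -‿inverseʳ _ ⟩
      0#                                ∎

-- Exponent vectors of the six variables x_ij, x_ik, x_il, x_jk, x_jl, x_kl, for indices i < j < k < l.
record Exp : Set where
  constructor exp
  field ij ik il jk jl kl : ℕ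

infixl 6 _⊕_
_⊕_ : Exp → Exp → Exp
exp a b c d e f ⊕ exp a′ b′ c′ d′ e′ f′ =
  exp (a ℕ.+ a′) (b ℕ.+ b′) (c ℕ.+ c′) (d ℕ.+ d′) (e ℕ.+ e′) (f ℕ.+ f′)

𝟙 xij xik xil xjk xjl xkl : Exp
𝟙 = exp 0 0 0 0 0 0
xij = exp 1 0 0 0 0 0
xik = exp 0 1 0 0 0 0
xil = exp 0 0 1 0 0 0
xjk = exp 0 0 0 1 0 0
xjl = exp 0 0 0 0 1 0
xkl = exp 0 0 0 0 0 1

-- The triples p < q < r inside i < j < k < l; pq, pr and qr below are their three variables.
data Fork₄ : Set where
  ijk ijl ikl jkl : Fork₄

pq pr qr : Fork₄ → Exp
pq ijk = xij
pq ijl = xij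
pq ikl = xik
pq jkl = xjk
pr ijk = xik
pr ijl = xil
pr ikl = xil
pr jkl = xjl
qr ijk = xjk
qr ijl = xjl
qr ikl = xkl
qr jkl = xkl

leadₑ : Fork₄ → Exp
leadₑ s = pr s ⊕ pq s

-- The triples whose leading monomial divides x_ij x_ik x_il, and the variable each one leaves over.
data ApexFork : Set where
  ijk ijl ikl : ApexFork

fork : ApexFork → Fork₄
fork ijk = ijk
fork ijl = ijl
fork ikl = ikl

third : ApexFork → Exp
third ijk = xil
third ijl = xik
third ikl = xij

-- A degree condition under which a monomial weighs less than x_ij x_ik x_il.
Small : Exp → Set
Small (exp a b c d e f) = T ((a ℕ.+ b ℕ.+ c ℕ.≤ᵇ 2) ∧ (a ℕ.+ b ℕ.+ c ℕ.+ (d ℕ.+ e ℕ.+ f) ℕ.≤ᵇ 3))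

apex-bound : ∀ A O {wᵢ wⱼ} → wⱼ ℕ.< wᵢ → A ℕ.≤ 2 → A ℕ.+ O ℕ.≤ 3 → A ℕ.* wᵢ ℕ.+ O ℕ.* wⱼ ℕ.< 3 ℕ.* wᵢ
apex-bound A zero {wᵢ} wⱼ<wᵢ A≤2 _ = begin-strict
  A ℕ.* wᵢ ℕ.+ 0   ≡⟨ ℕP.+-identityʳ _ ⟩
  A ℕ.* wᵢ          ≤⟨ ℕP.*-monoˡ-≤ wᵢ A≤2 ⟩
  2 ℕ.* wᵢ          <⟨ ℕP.*-monoˡ-< wᵢ {{ℕ.>-nonZero (ℕP.≤-<-trans z≤n wⱼ<wᵢ)}} (ℕP.n<1+n 2) ⟩
  3 ℕ.* wᵢ          ∎
  where open ℕP.≤-Reasoning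
apex-bound A O@(suc _) {wᵢ} {wⱼ} wⱼ<wᵢ _ A+O≤3 = begin-strict
  A ℕ.* wᵢ ℕ.+ O ℕ.* wⱼ   <⟨ ℕP.+-monoʳ-< (A ℕ.* wᵢ) (ℕP.*-monoʳ-< O wⱼ<wᵢ) ⟩
  A ℕ.* wᵢ ℕ.+ O ℕ.* wᵢ   ≡⟨ ℕP.*-distribʳ-+ wᵢ A O ⟨
  (A ℕ.+ O) ℕ.* wᵢ        ≤⟨ ℕP.*-monoˡ-≤ wᵢ A+O≤3 ⟩
  3 ℕ.* wᵢ                ∎
  where open ℕP.≤-Reasoning

small-bound : ∀ a b c d e f {wᵢ wⱼ wₖ} → wₖ ℕ.≤ wⱼ → wⱼ ℕ.< wᵢ → Small (exp a b c d e f) →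
  a ℕ.* wᵢ ℕ.+ (b ℕ.* wᵢ ℕ.+ (c ℕ.* wᵢ ℕ.+ (d ℕ.* wⱼ ℕ.+ (e ℕ.* wⱼ ℕ.+ f ℕ.* wₖ))))
  ℕ.< 1 ℕ.* wᵢ ℕ.+ (1 ℕ.* wᵢ ℕ.+ (1 ℕ.* wᵢ ℕ.+ (0 ℕ.* wⱼ ℕ.+ (0 ℕ.* wⱼ ℕ.+ 0 ℕ.* wₖ))))
small-bound a b c d e f {wᵢ} {wⱼ} {wₖ} wₖ≤wⱼ wⱼ<wᵢ small = begin-strict
  a ℕ.* wᵢ ℕ.+ (b ℕ.* wᵢ ℕ.+ (c ℕ.* wᵢ ℕ.+ (d ℕ.* wⱼ ℕ.+ (e ℕ.* wⱼ ℕ.+ f ℕ.* wₖ))))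
    ≡⟨ regroup a b c d e f wᵢ wⱼ wₖ ⟩
  A ℕ.* wᵢ ℕ.+ ((d ℕ.+ e) ℕ.* wⱼ ℕ.+ f ℕ.* wₖ)
    ≤⟨ ℕP.+-monoʳ-≤ (A ℕ.* wᵢ) (ℕP.+-monoʳ-≤ ((d ℕ.+ e) ℕ.* wⱼ) (ℕP.*-monoʳ-≤ f wₖ≤wⱼ)) ⟩
  A ℕ.* wᵢ ℕ.+ ((d ℕ.+ e) ℕ.* wⱼ ℕ.+ f ℕ.* wⱼ)
    ≡⟨ P.cong (A ℕ.* wᵢ ℕ.+_) (P.sym (ℕP.*-distribʳ-+ wⱼ (d ℕ.+ e) f)) ⟩
  A ℕ.* wᵢ ℕ.+ O ℕ.* wⱼ
    <⟨ apex-bound A O wⱼ<wᵢ (ℕP.≤ᵇ⇒≤ A 2 (proj₁ bounds)) (ℕP.≤ᵇ⇒≤ (A ℕ.+ O) 3 (proj₂ bounds)) ⟩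
  3 ℕ.* wᵢ
    ≡⟨ three wᵢ wⱼ wₖ ⟩
  1 ℕ.* wᵢ ℕ.+ (1 ℕ.* wᵢ ℕ.+ (1 ℕ.* wᵢ ℕ.+ (0 ℕ.* wⱼ ℕ.+ (0 ℕ.* wⱼ ℕ.+ 0 ℕ.* wₖ)))) ∎
  where
  open ℕP.≤-Reasoning
  A O : ℕ
  A = a ℕ.+ b ℕ.+ c
  O = d ℕ.+ e ℕ.+ f
  bounds : T (A ℕ.≤ᵇ 2) × T (A ℕ.+ O ℕ.≤ᵇ 3)
  bounds = Equivalence.to T-∧ small
  regroup : ∀ a b c d e f x y z → a ℕ.* x ℕ.+ (b ℕ.* x ℕ.+ (c ℕ.* x ℕ.+ (d ℕ.* y ℕ.+ (e ℕ.* y ℕ.+ f ℕ.* z))))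
                                 ≡ (a ℕ.+ b ℕ.+ c) ℕ.* x ℕ.+ ((d ℕ.+ e) ℕ.* y ℕ.+ f ℕ.* z)
  regroup = solve-∀
  three : ∀ x y z → 3 ℕ.* x ≡ 1 ℕ.* x ℕ.+ (1 ℕ.* x ℕ.+ (1 ℕ.* x ℕ.+ (0 ℕ.* y ℕ.+ (0 ℕ.* y ℕ.+ 0 ℕ.* z))))
  three = solve-∀

module Rewriting {c ℓ} (R : CommutativeRing c ℓ) (n : ℕ) (β α : CommutativeRing.Carrier R) where
  open CommutativeRing R
  open Poly R n
  open Pairing R
  open Monomials R n
  open Polynomials R n
  open IntegerCoefficientSolver R using (solve; _:=_; _:+_; _:*_; :-_; con)
  open import Relation.Binary.Reasoning.Setoid setoid

  rhs : ∀ {M : Set} → M → M → M → M → Combination M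
  rhs a b c d = (1# , a) ∷ (- 1# , b) ∷ (- β , c) ∷ (- α , d) ∷ []

  -- gen β α t, read as the rule lead t → rule t.
  lead r₁ r₂ r₃ : Triple → Mon
  lead ((i , j , k) , _) = varₘ i k *ₘ varₘ i j
  r₁ ((i , j , k) , _) = varₘ i j *ₘ varₘ j k
  r₂ ((i , j , k) , _) = varₘ i k *ₘ varₘ j k
  r₃ ((i , j , k) , _) = varₘ i k

  rule : Triple → Pol
  rule t = rhs (r₁ t) (r₂ t) (r₃ t) 1ₘ

  _·ₘ_ : Mon → Pol → Pol
  u ·ₘ p = map (λ e → (proj₁ e , u *ₘ proj₂ e)) p

  Reduces : (Mon → Carrier) → Mon → Triple → Set ℓ
  Reduces φ u t = φ (u *ₘ lead t) ≈ ⟨ rule t ∣ φ ∘ (u *ₘ_) ⟩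

  pairing-gen : ∀ {ψ} → Respects ψ → ∀ t → ⟨ gen β α t ∣ ψ ⟩ ≈ ⟨ rule t ∣ ψ ⟩ - ψ (lead t)
  pairing-gen {ψ} resp t@((i , j , k) , _) = begin
    ⟨ gen β α t ∣ ψ ⟩
      ≈⟨ +-congˡ (+-congˡ (+-congˡ (+-congʳ (*-congˡ (resp (≈ₘ⇒≃ λ a b _ → ℕP.+-identityʳ (varₘ i k a b))))))) ⟩
    1# * 1# * ψ (r₁ t) + (- (1# * 1#) * ψ (lead t) + (- (1# * 1#) * ψ (r₂ t) + (- (1# * β) * ψ (r₃ t) + (- α * ψ 1ₘ + 0#))))
      ≈⟨ identity (ψ (r₁ t)) (ψ (lead t)) (ψ (r₂ t)) (ψ (r₃ t)) (ψ 1ₘ) ⟩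
    ⟨ rule t ∣ ψ ⟩ - ψ (lead t) ∎
    where
    identity : ∀ x l y z w →
      1# * 1# * x + (- (1# * 1#) * l + (- (1# * 1#) * y + (- (1# * β) * z + (- α * w + 0#))))
      ≈ (1# * x + (- 1# * y + (- β * z + (- α * w + 0#)))) - l
    identity = solve 7 (λ b a x l y z w →
      let one = con (+ 1) in
      one :* one :* x :+ (:- (one :* one) :* l :+ (:- (one :* one) :* y :+ (:- (one :* b) :* z :+ (:- a :* w :+ con (+ 0)))))
      := (one :* x :+ (:- one :* y :+ (:- b :* z :+ (:- a :* w :+ con (+ 0))))) :+ :- l) refl β α

  W-*ₘ-monoʳ-< : ∀ u {m l} → W m ℕ.< W l → W (u *ₘ m) ℕ.< W (u *ₘ l)
  W-*ₘ-monoʳ-< u {m} {l} m<l = P.subst₂ ℕ._<_ (P.sym (W-*ₘ u m)) (P.sym (W-*ₘ u l)) (ℕP.+-monoʳ-< (W u) m<l)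

  rule-lighter : ∀ t → All (λ e → W (proj₂ e) ℕ.< W (lead t)) (rule t)
  rule-lighter ((i , j , k) , i<j , j<k) =
    lighter W-r₁ (ℕP.+-monoʳ-< wᵢ wⱼ<wᵢ) ∷ lighter W-r₂ (ℕP.+-monoʳ-< wᵢ wⱼ<wᵢ) ∷
    lighter (W-varₘ i<k) (ℕP.m<m+n wᵢ 0<wᵢ) ∷ lighter W-1ₘ (ℕP.<-≤-trans 0<wᵢ (ℕP.m≤m+n wᵢ wᵢ)) ∷ []
    where
    i<k : i Fin.< k
    i<k = FinP.<-trans i<j j<k
    wᵢ wⱼ : ℕ
    wᵢ = n ℕ.∸ toℕ i
    wⱼ = n ℕ.∸ toℕ j
    0<wᵢ : 0 ℕ.< wᵢ
    0<wᵢ = ℕP.m<n⇒0<n∸m (FinP.toℕ<n i)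
    wⱼ<wᵢ : wⱼ ℕ.< wᵢ
    wⱼ<wᵢ = ℕP.∸-monoʳ-< i<j (ℕP.<⇒≤ (FinP.toℕ<n j))
    W-lead : W (varₘ i k *ₘ varₘ i j) ≡ wᵢ ℕ.+ wᵢ
    W-lead = P.trans (W-*ₘ _ _) (P.cong₂ ℕ._+_ (W-varₘ i<k) (W-varₘ i<j))
    W-r₁ : W (varₘ i j *ₘ varₘ j k) ≡ wᵢ ℕ.+ wⱼ
    W-r₁ = P.trans (W-*ₘ _ _) (P.cong₂ ℕ._+_ (W-varₘ i<j) (W-varₘ j<k))
    W-r₂ : W (varₘ i k *ₘ varₘ j k) ≡ wᵢ ℕ.+ wⱼ
    W-r₂ = P.trans (W-*ₘ _ _) (P.cong₂ ℕ._+_ (W-varₘ i<k) (W-varₘ j<k))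
    lighter : ∀ {m w} → W m ≡ w → w ℕ.< wᵢ ℕ.+ wᵢ → W m ℕ.< W (varₘ i k *ₘ varₘ i j)
    lighter W≡w w<2wᵢ = P.subst₂ ℕ._<_ (P.sym W≡w) (P.sym W-lead) w<2wᵢ

  rule-cong : ∀ t φ ψ → (∀ {m} → W m ℕ.< W (lead t) → φ m ≈ ψ m) → ⟨ rule t ∣ φ ⟩ ≈ ⟨ rule t ∣ ψ ⟩
  rule-cong t φ ψ φ≈ψ = pairing-congᴬ (All.map φ≈ψ (rule-lighter t))

  HasFork : Mon → Set
  HasFork m = ∃ λ i → ∃ λ j → ∃ λ k → i Fin.< j × j Fin.< k × 1 ℕ.≤ m i j × 1 ℕ.≤ m i k

  fork? : ∀ m → Dec (HasFork m)
  fork? m = FinP.any? λ i → FinP.any? λ j → FinP.any? λ k →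
    (i FinP.<? j) ×-dec (j FinP.<? k) ×-dec (1 ℕ.≤? m i j) ×-dec (1 ℕ.≤? m i k)

  forkTriple : ∀ {m} → HasFork m → Triple
  forkTriple (i , j , k , i<j , j<k , _) = (i , j , k) , i<j , j<k

  lead-≤ₘ : ∀ {m} (h : HasFork m) → lead (forkTriple h) ≤ₘ m
  lead-≤ₘ (i , j , k , i<j , j<k , 1≤mij , 1≤mik) =
    *ₘ-≤ₘ (varₘ-disjoint (λ (_ , k≡j) → FinP.<⇒≢ j<k (P.sym k≡j))) (varₘ-≤ₘ 1≤mik) (varₘ-≤ₘ 1≤mij)

  lead-entries : ∀ {m} i j k (i<j : i Fin.< j) (j<k : j Fin.< k) → lead ((i , j , k) , i<j , j<k) ≤ₘ m →
    1 ℕ.≤ m i j × 1 ℕ.≤ m i k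
  lead-entries i j k i<j j<k lead≤m =
    ≤ₘ-varₘ i<j (≤ₘ-trans (≤ₘ-*ₘʳ (varₘ i k) ≃-refl) lead≤m) ,
    ≤ₘ-varₘ (FinP.<-trans i<j j<k) (≤ₘ-trans (≤ₘ-*ₘˡ (varₘ i j) ≃-refl) lead≤m)

  divisible⇒fork : ∀ {m} u t → m ≃ u *ₘ lead t → HasFork m
  divisible⇒fork u ((i , j , k) , i<j , j<k) m≃ul = i , j , k , i<j , j<k , lead-entries i j k i<j j<k (≤ₘ-*ₘʳ u m≃ul)

  fork-resp : ∀ {m m′} → m ≃ m′ → HasFork m → HasFork m′
  fork-resp (≈ₘ⇒≃ m≈m′) (i , j , k , i<j , j<k , mij , mik) =
    i , j , k , i<j , j<k , P.subst (1 ℕ.≤_) (m≈m′ i j i<j) mij , P.subst (1 ℕ.≤_) (m≈m′ i k (FinP.<-trans i<j j<k)) mik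

  ruleₑ : Fork₄ → Combination Exp
  ruleₑ s = rhs (pq s ⊕ qr s) (pr s ⊕ qr s) (pr s) 𝟙

  -- ⟨ rhs a b c d ∣ f ⟩ is ρ (f a) (f b) (f c) (f d) by definition.
  ρ : Carrier → Carrier → Carrier → Carrier → Carrier
  ρ a b c d = 1# * a + (- 1# * b + (- β * c + (- α * d + 0#)))

  ρ-cong : ∀ {a a′ b b′ c c′ d d′} → a ≈ a′ → b ≈ b′ → c ≈ c′ → d ≈ d′ → ρ a b c d ≈ ρ a′ b′ c′ d′
  ρ-cong a≈ b≈ c≈ d≈ = +-cong (*-congˡ a≈) (+-cong (*-congˡ b≈) (+-cong (*-congˡ c≈) (+-congʳ (*-congˡ d≈))))

  -- The three ways of reducing x_ij x_ik x_il, each followed down to forkless monomials.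
  module CriticalPair (f : Exp → Carrier)
    (reduces : ∀ s e → Small (e ⊕ leadₑ s) → f (e ⊕ leadₑ s) ≈ ⟨ ruleₑ s ∣ f ∘ (e ⊕_) ⟩) where

    -- The variables are named after forkless monomials: a, b, c, p, q, s stand for x_ij, x_ik, x_il, x_jk, x_jl, x_kl
    -- and z for 1.
    private
      ijk≈ijl : ∀ aps aqs aq a cps cqs cq c cp p bps bs cs z bqs bq b q →
        ρ (ρ (ρ aps aqs aq a) (ρ cps cqs cq c) cp p) (ρ bps cps cp p) (ρ bs cs c z) c
        ≈ ρ (ρ (ρ aps aqs aq a) (ρ bps bqs bq b) bq q) (ρ bqs cqs cq q) (ρ bs cs c z) b
      ijk≈ijl = solve 20 (λ β α aps aqs aq a cps cqs cq c cp p bps bs cs z bqs bq b q →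
        let ρ′ = λ x y z w → con (+ 1) :* x :+ (:- con (+ 1) :* y :+ (:- β :* z :+ (:- α :* w :+ con (+ 0)))) in
        ρ′ (ρ′ (ρ′ aps aqs aq a) (ρ′ cps cqs cq c) cp p) (ρ′ bps cps cp p) (ρ′ bs cs c z) c
        := ρ′ (ρ′ (ρ′ aps aqs aq a) (ρ′ bps bqs bq b) bq q) (ρ′ bqs cqs cq q) (ρ′ bs cs c z) b) refl β α

      ijk≈ikl : ∀ aps aqs aq a cps cqs cq c cp p bps bs cs z s →
        ρ (ρ (ρ aps aqs aq a) (ρ cps cqs cq c) cp p) (ρ bps cps cp p) (ρ bs cs c z) c
        ≈ ρ (ρ aps bps bs s) (ρ aqs cqs cs s) (ρ aq cq c z) a
      ijk≈ikl = solve 17 (λ β α aps aqs aq a cps cqs cq c cp p bps bs cs z s →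
        let ρ′ = λ x y z w → con (+ 1) :* x :+ (:- con (+ 1) :* y :+ (:- β :* z :+ (:- α :* w :+ con (+ 0)))) in
        ρ′ (ρ′ (ρ′ aps aqs aq a) (ρ′ cps cqs cq c) cp p) (ρ′ bps cps cp p) (ρ′ bs cs c z) c
        := ρ′ (ρ′ aps bps bs s) (ρ′ aqs cqs cs s) (ρ′ aq cq c z) a) refl β α

    critical-ijl : ⟨ ruleₑ ijk ∣ f ∘ (xil ⊕_) ⟩ ≈ ⟨ ruleₑ ijl ∣ f ∘ (xik ⊕_) ⟩
    critical-ijl = trans
      (ρ-cong (trans (reduces ijl xjk _) (ρ-cong (reduces jkl xij _) (reduces jkl xil _) refl refl))
              (reduces ikl xjk _) (reduces ikl 𝟙 _) refl) (trans (ijk≈ijl _ _ _ _ _ _ _ _ _ _ _ _ _ _ _ _ _ _) (sym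
      (ρ-cong (trans (reduces ijk xjl _) (ρ-cong (reduces jkl xij _) (reduces jkl xik _) refl refl))
              (reduces ikl xjl _) (reduces ikl 𝟙 _) refl)))

    critical-ikl : ⟨ ruleₑ ijk ∣ f ∘ (xil ⊕_) ⟩ ≈ ⟨ ruleₑ ikl ∣ f ∘ (xij ⊕_) ⟩
    critical-ikl = trans
      (ρ-cong (trans (reduces ijl xjk _) (ρ-cong (reduces jkl xij _) (reduces jkl xil _) refl refl))
              (reduces ikl xjk _) (reduces ikl 𝟙 _) refl) (trans (ijk≈ikl _ _ _ _ _ _ _ _ _ _ _ _ _ _ _) (sym
      (ρ-cong (reduces ijk xkl _) (reduces ijl xkl _) (reduces ijl 𝟙 _) refl)))

    critical : ∀ s → ⟨ ruleₑ (fork s) ∣ f ∘ (third s ⊕_) ⟩ ≈ ⟨ ruleₑ ijk ∣ f ∘ (xil ⊕_) ⟩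
    critical ijk = refl
    critical ijl = sym critical-ijl
    critical ikl = sym critical-ikl

  module Configuration {i j k l : Fin n} (i<j : i Fin.< j) (j<k : j Fin.< k) (k<l : k Fin.< l) where
    ⟦_⟧ : Exp → Mon
    ⟦ exp a b c d e f ⟧ =
      (varₘ i j ^ₘ a) *ₘ ((varₘ i k ^ₘ b) *ₘ ((varₘ i l ^ₘ c) *ₘ ((varₘ j k ^ₘ d) *ₘ ((varₘ j l ^ₘ e) *ₘ (varₘ k l ^ₘ f)))))

    apex : Exp
    apex = xij ⊕ xik ⊕ xil

    wᵢ wⱼ wₖ : ℕ
    wᵢ = n ℕ.∸ toℕ i
    wⱼ = n ℕ.∸ toℕ j
    wₖ = n ℕ.∸ toℕ k

    indices : Fork₄ → Fin n × Fin n × Fin n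
    indices ijk = i , j , k
    indices ijl = i , j , l
    indices ikl = i , k , l
    indices jkl = j , k , l

    triple : Fork₄ → Triple
    triple s = indices s , ordered s
      where
      ordered : ∀ s → proj₁ (indices s) Fin.< proj₁ (proj₂ (indices s)) × proj₁ (proj₂ (indices s)) Fin.< proj₂ (proj₂ (indices s))
      ordered ijk = i<j , j<k
      ordered ijl = i<j , FinP.<-trans j<k k<l
      ordered ikl = FinP.<-trans i<j j<k , k<l
      ordered jkl = j<k , k<l

    ⟦⟧-⊕ : ∀ e e′ → ⟦ e ⊕ e′ ⟧ ≃ ⟦ e ⟧ *ₘ ⟦ e′ ⟧
    ⟦⟧-⊕ (exp a b c d e f) (exp a′ b′ c′ d′ e′ f′) = ≈ₘ⇒≃ λ x y _ → pointwise a b c d e f a′ b′ c′ d′ e′ f′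
      (varₘ i j x y) (varₘ i k x y) (varₘ i l x y) (varₘ j k x y) (varₘ j l x y) (varₘ k l x y)
      where
      pointwise : ∀ a b c d e f a′ b′ c′ d′ e′ f′ v₁ v₂ v₃ v₄ v₅ v₆ →
        (a ℕ.+ a′) ℕ.* v₁ ℕ.+ ((b ℕ.+ b′) ℕ.* v₂ ℕ.+ ((c ℕ.+ c′) ℕ.* v₃ ℕ.+
          ((d ℕ.+ d′) ℕ.* v₄ ℕ.+ ((e ℕ.+ e′) ℕ.* v₅ ℕ.+ (f ℕ.+ f′) ℕ.* v₆))))
        ≡ (a ℕ.* v₁ ℕ.+ (b ℕ.* v₂ ℕ.+ (c ℕ.* v₃ ℕ.+ (d ℕ.* v₄ ℕ.+ (e ℕ.* v₅ ℕ.+ f ℕ.* v₆)))))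
          ℕ.+ (a′ ℕ.* v₁ ℕ.+ (b′ ℕ.* v₂ ℕ.+ (c′ ℕ.* v₃ ℕ.+ (d′ ℕ.* v₄ ℕ.+ (e′ ℕ.* v₅ ℕ.+ f′ ℕ.* v₆)))))
      pointwise = solve-∀

    ⟦𝟙⟧ : ⟦ 𝟙 ⟧ ≃ 1ₘ
    ⟦𝟙⟧ = ≃-refl

    private
      ⟦unit⟧ : ∀ e {a b} → (∀ x y → ⟦ e ⟧ x y ≡ varₘ a b x y ℕ.+ 0 ℕ.+ 0) → ⟦ e ⟧ ≃ varₘ a b
      ⟦unit⟧ e {a} {b} eq = ≈ₘ⇒≃ λ x y _ → P.trans (eq x y) (P.trans (ℕP.+-identityʳ _) (ℕP.+-identityʳ (varₘ a b x y)))

      ⟦pq⟧ : ∀ s → ⟦ pq s ⟧ ≃ varₘ (proj₁ (indices s)) (proj₁ (proj₂ (indices s)))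
      ⟦pq⟧ ijk = ⟦unit⟧ (pq ijk) λ _ _ → P.refl
      ⟦pq⟧ ijl = ⟦unit⟧ (pq ijl) λ _ _ → P.refl
      ⟦pq⟧ ikl = ⟦unit⟧ (pq ikl) λ _ _ → P.refl
      ⟦pq⟧ jkl = ⟦unit⟧ (pq jkl) λ _ _ → P.refl

      ⟦pr⟧ : ∀ s → ⟦ pr s ⟧ ≃ varₘ (proj₁ (indices s)) (proj₂ (proj₂ (indices s)))
      ⟦pr⟧ ijk = ⟦unit⟧ (pr ijk) λ _ _ → P.refl
      ⟦pr⟧ ijl = ⟦unit⟧ (pr ijl) λ _ _ → P.refl
      ⟦pr⟧ ikl = ⟦unit⟧ (pr ikl) λ _ _ → P.refl
      ⟦pr⟧ jkl = ⟦unit⟧ (pr jkl) λ _ _ → P.refl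

      ⟦qr⟧ : ∀ s → ⟦ qr s ⟧ ≃ varₘ (proj₁ (proj₂ (indices s))) (proj₂ (proj₂ (indices s)))
      ⟦qr⟧ ijk = ⟦unit⟧ (qr ijk) λ _ _ → P.refl
      ⟦qr⟧ ijl = ⟦unit⟧ (qr ijl) λ _ _ → P.refl
      ⟦qr⟧ ikl = ⟦unit⟧ (qr ikl) λ _ _ → P.sym (ℕP.+-identityʳ _)
      ⟦qr⟧ jkl = ⟦unit⟧ (qr jkl) λ _ _ → P.sym (ℕP.+-identityʳ _)

    ⟦leadₑ⟧ : ∀ s → ⟦ leadₑ s ⟧ ≃ lead (triple s)
    ⟦leadₑ⟧ s = ≃-trans (⟦⟧-⊕ (pr s) (pq s)) (*ₘ-cong (⟦pr⟧ s) (⟦pq⟧ s))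

    ⟦r₁ₑ⟧ : ∀ s → ⟦ pq s ⊕ qr s ⟧ ≃ r₁ (triple s)
    ⟦r₁ₑ⟧ s = ≃-trans (⟦⟧-⊕ (pq s) (qr s)) (*ₘ-cong (⟦pq⟧ s) (⟦qr⟧ s))

    ⟦r₂ₑ⟧ : ∀ s → ⟦ pr s ⊕ qr s ⟧ ≃ r₂ (triple s)
    ⟦r₂ₑ⟧ s = ≃-trans (⟦⟧-⊕ (pr s) (qr s)) (*ₘ-cong (⟦pr⟧ s) (⟦qr⟧ s))

    ⟦r₃ₑ⟧ : ∀ s → ⟦ pr s ⟧ ≃ r₃ (triple s)
    ⟦r₃ₑ⟧ = ⟦pr⟧

    W⟦⟧ : ∀ e → W ⟦ e ⟧ ≡ Exp.ij e ℕ.* wᵢ ℕ.+ (Exp.ik e ℕ.* wᵢ ℕ.+ (Exp.il e ℕ.* wᵢ ℕ.+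
                          (Exp.jk e ℕ.* wⱼ ℕ.+ (Exp.jl e ℕ.* wⱼ ℕ.+ Exp.kl e ℕ.* wₖ))))
    W⟦⟧ (exp a b c d e f) =
      product (varₘ i j ^ₘ a) (W-pow i<j a) (
      product (varₘ i k ^ₘ b) (W-pow (FinP.<-trans i<j j<k) b) (
      product (varₘ i l ^ₘ c) (W-pow (FinP.<-trans i<j (FinP.<-trans j<k k<l)) c) (
      product (varₘ j k ^ₘ d) (W-pow j<k d) (
      product (varₘ j l ^ₘ e) (W-pow (FinP.<-trans j<k k<l) e) (W-pow k<l f)))))
      where
      W-pow : ∀ {a b} → a Fin.< b → ∀ x → W (varₘ a b ^ₘ x) ≡ x ℕ.* (n ℕ.∸ toℕ a)
      W-pow a<b x = P.trans (W-^ₘ _ x) (P.cong (x ℕ.*_) (W-varₘ a<b))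
      product : ∀ m {m′ x y} → W m ≡ x → W m′ ≡ y → W (m *ₘ m′) ≡ x ℕ.+ y
      product m {m′} W≡x W≡y = P.trans (W-*ₘ m m′) (P.cong₂ ℕ._+_ W≡x W≡y)

    small-lighter : ∀ e → Small e → W ⟦ e ⟧ ℕ.< W ⟦ apex ⟧
    small-lighter e@(exp a b c d f g) small = P.subst₂ ℕ._<_ (P.sym (W⟦⟧ e)) (P.sym (W⟦⟧ apex))
      (small-bound a b c d f g (ℕP.∸-monoʳ-≤ n (ℕP.<⇒≤ j<k)) (ℕP.∸-monoʳ-< i<j (ℕP.<⇒≤ (FinP.toℕ<n j))) small)

    apex-split : ∀ s → ⟦ apex ⟧ ≃ ⟦ third s ⊕ leadₑ (fork s) ⟧
    apex-split ijk = ≃-refl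
    apex-split ijl = ≃-refl
    apex-split ikl = ≃-refl

    apex-≤ₘ : ∀ {m} → 1 ℕ.≤ m i j → 1 ℕ.≤ m i k → 1 ℕ.≤ m i l → ⟦ apex ⟧ ≤ₘ m
    apex-≤ₘ mij mik mil = ≤ₘ-respˡ apex≃
      (*ₘ-≤ₘ (disjoint-sym (disjoint-*ₘ (varₘ-disjoint (l≢j ∘ proj₂)) (varₘ-disjoint (l≢k ∘ proj₂))))
             (*ₘ-≤ₘ (varₘ-disjoint (j≢k ∘ proj₂)) (varₘ-≤ₘ mij) (varₘ-≤ₘ mik)) (varₘ-≤ₘ mil))
      where
      j≢k : j ≢ k
      j≢k = FinP.<⇒≢ j<k
      l≢j : l ≢ j
      l≢j = FinP.<⇒≢ (FinP.<-trans j<k k<l) ∘ P.sym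
      l≢k : l ≢ k
      l≢k = FinP.<⇒≢ k<l ∘ P.sym
      apex≃ : ⟦ apex ⟧ ≃ (varₘ i j *ₘ varₘ i k) *ₘ varₘ i l
      apex≃ = ≃-trans (⟦⟧-⊕ (xij ⊕ xik) xil) (*ₘ-cong (≃-trans (⟦⟧-⊕ xij xik) (*ₘ-cong (⟦pq⟧ ijk) (⟦pr⟧ ijk))) (⟦pr⟧ ijl))

    ⟦⊕leadₑ⟧ : ∀ v e s → v *ₘ ⟦ e ⊕ leadₑ s ⟧ ≃ (v *ₘ ⟦ e ⟧) *ₘ lead (triple s)
    ⟦⊕leadₑ⟧ v e s = ≃-trans (*ₘ-cong (≃-refl {v}) (≃-trans (⟦⟧-⊕ e (leadₑ s)) (*ₘ-cong (≃-refl {⟦ e ⟧}) (⟦leadₑ⟧ s))))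
                             (≃-sym (*ₘ-assoc v ⟦ e ⟧ (lead (triple s))))

  module LocalConfluence (φ : Mon → Carrier) (M : Mon)
    (resp : ∀ {m m′} → W m ℕ.< W M → m ≃ m′ → φ m ≈ φ m′)
    (reduces : ∀ u t → W (u *ₘ lead t) ℕ.< W M → Reduces φ u t) where
    open import Algebra.Properties.CommutativeSemigroup
      (CommutativeMonoid.commutativeSemigroup *ₘ-commutativeMonoid) using (xy∙z≈xz∙y; x∙yz≈xz∙y)

    Joinable : Mon → Triple → Mon → Triple → Set ℓ
    Joinable u₁ t₁ u₂ t₂ = ⟨ rule t₁ ∣ φ ∘ (u₁ *ₘ_) ⟩ ≈ ⟨ rule t₂ ∣ φ ∘ (u₂ *ₘ_) ⟩

    private
      below : ∀ u t {m} → M ≃ u *ₘ lead t → W m ℕ.< W (lead t) → W (u *ₘ m) ℕ.< W M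
      below u t {m} M≃ul m<l = P.subst (W (u *ₘ m) ℕ.<_) (P.sym (W-resp M≃ul)) (W-*ₘ-monoʳ-< u m<l)

      below-≃ : ∀ {m m′} → m ≃ m′ → W m ℕ.< W M → W m′ ℕ.< W M
      below-≃ m≃m′ = P.subst (ℕ._< W M) (W-resp m≃m′)

      expand-twice : ∀ u₁ t₁ v t₂ → M ≃ u₁ *ₘ lead t₁ → u₁ ≃ v *ₘ lead t₂ →
        ⟨ rule t₁ ∣ φ ∘ (u₁ *ₘ_) ⟩ ≈ ⟨ rule t₁ ∣ (λ m → ⟨ rule t₂ ∣ (λ m′ → φ ((v *ₘ m) *ₘ m′)) ⟩) ⟩
      expand-twice u₁ t₁ v t₂ M≃u₁l₁ u₁≃vl₂ = rule-cong t₁ _ _ λ {m} m<l₁ →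
        let u₁m≃vml₂ = ≃-trans (*ₘ-cong u₁≃vl₂ (≃-refl {m})) (xy∙z≈xz∙y v (lead t₂) m) in
        trans (resp (below u₁ t₁ M≃u₁l₁ m<l₁) u₁m≃vml₂) (reduces (v *ₘ m) t₂ (below-≃ u₁m≃vml₂ (below u₁ t₁ M≃u₁l₁ m<l₁)))

    joinable-same : ∀ u₁ u₂ t → M ≃ u₁ *ₘ lead t → M ≃ u₂ *ₘ lead t → Joinable u₁ t u₂ t
    joinable-same u₁ u₂ t M≃u₁l M≃u₂l =
      rule-cong t (φ ∘ (u₁ *ₘ_)) (φ ∘ (u₂ *ₘ_)) λ {m} m<l → resp (below u₁ t M≃u₁l m<l) (*ₘ-cong u₁≃u₂ (≃-refl {m}))
      where
      u₁≃u₂ : u₁ ≃ u₂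
      u₁≃u₂ = *ₘ-cancelʳ (lead t) (≃-trans (≃-sym M≃u₁l) M≃u₂l)

    joinable-disjoint : ∀ u₁ t₁ u₂ t₂ → Disjoint (lead t₁) (lead t₂) →
      M ≃ u₁ *ₘ lead t₁ → M ≃ u₂ *ₘ lead t₂ → Joinable u₁ t₁ u₂ t₂
    joinable-disjoint u₁ t₁ u₂ t₂ l₁#l₂ M≃u₁l₁ M≃u₂l₂ = begin
      ⟨ rule t₁ ∣ φ ∘ (u₁ *ₘ_) ⟩                                                  ≈⟨ expand-twice u₁ t₁ v t₂ M≃u₁l₁ u₁≃vl₂ ⟩
      ⟨ rule t₁ ∣ (λ m → ⟨ rule t₂ ∣ (λ m′ → φ ((v *ₘ m) *ₘ m′)) ⟩) ⟩
        ≈⟨ pairing-swap (rule t₁) (rule t₂) (λ m m′ → φ ((v *ₘ m) *ₘ m′)) ⟩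
      ⟨ rule t₂ ∣ (λ m′ → ⟨ rule t₁ ∣ (λ m → φ ((v *ₘ m) *ₘ m′)) ⟩) ⟩
        ≈⟨ rule-cong t₂ _ _ (λ {m′} m′<l₂ → rule-cong t₁ _ _ λ {m} m<l₁ →
                                                                                      resp (lighter m<l₁ m′<l₂) (xy∙z≈xz∙y v m m′)) ⟩
      ⟨ rule t₂ ∣ (λ m′ → ⟨ rule t₁ ∣ (λ m → φ ((v *ₘ m′) *ₘ m)) ⟩) ⟩            ≈⟨ expand-twice u₂ t₂ v t₁ M≃u₂l₂ u₂≃vl₁ ⟨
      ⟨ rule t₂ ∣ φ ∘ (u₂ *ₘ_) ⟩                                                  ∎
      where
      v : Mon
      v = M ∸ₘ (lead t₁ *ₘ lead t₂)
      M≃vl₁l₂ : M ≃ v *ₘ (lead t₁ *ₘ lead t₂)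
      M≃vl₁l₂ = ∸ₘ-*ₘ (*ₘ-≤ₘ l₁#l₂ (≤ₘ-*ₘʳ u₁ M≃u₁l₁) (≤ₘ-*ₘʳ u₂ M≃u₂l₂))
      u₁≃vl₂ : u₁ ≃ v *ₘ lead t₂
      u₁≃vl₂ = *ₘ-cancelʳ (lead t₁) (≃-trans (≃-sym M≃u₁l₁) (≃-trans M≃vl₁l₂ (x∙yz≈xz∙y v _ _)))
      u₂≃vl₁ : u₂ ≃ v *ₘ lead t₁
      u₂≃vl₁ = *ₘ-cancelʳ (lead t₂) (≃-trans (≃-sym M≃u₂l₂) (≃-trans M≃vl₁l₂ (≃-sym (*ₘ-assoc v _ _))))
      lighter : ∀ {m m′} → W m ℕ.< W (lead t₁) → W m′ ℕ.< W (lead t₂) → W ((v *ₘ m) *ₘ m′) ℕ.< W M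
      lighter {m} {m′} m<l₁ m′<l₂ = ℕP.<-trans (W-*ₘ-monoʳ-< (v *ₘ m) m′<l₂)
        (below-≃ (≃-trans (*ₘ-cong u₁≃vl₂ (≃-refl {m})) (xy∙z≈xz∙y v _ m)) (below u₁ t₁ M≃u₁l₁ m<l₁))

    module _ {i j k l : Fin n} (i<j : i Fin.< j) (j<k : j Fin.< k) (k<l : k Fin.< l) where
      open Configuration i<j j<k k<l

      joinable-apex : 1 ℕ.≤ M i j → 1 ℕ.≤ M i k → 1 ℕ.≤ M i l → ∀ s₁ s₂ u₁ u₂ →
        M ≃ u₁ *ₘ lead (triple (fork s₁)) → M ≃ u₂ *ₘ lead (triple (fork s₂)) →
        Joinable u₁ (triple (fork s₁)) u₂ (triple (fork s₂))
      joinable-apex Mij Mik Mil s₁ s₂ u₁ u₂ M≃u₁l₁ M≃u₂l₂ =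
        trans (via s₁ u₁ M≃u₁l₁) (trans (critical s₁) (sym (trans (via s₂ u₂ M≃u₂l₂) (critical s₂))))
        where
        v : Mon
        v = M ∸ₘ ⟦ apex ⟧

        M≃v·apex : M ≃ v *ₘ ⟦ apex ⟧
        M≃v·apex = ∸ₘ-*ₘ (apex-≤ₘ Mij Mik Mil)

        f : Exp → Carrier
        f e = φ (v *ₘ ⟦ e ⟧)

        bridge : ∀ e s u → u ≃ v *ₘ ⟦ e ⟧ → W (u *ₘ lead (triple s)) ℕ.≤ W M →
          ⟨ rule (triple s) ∣ φ ∘ (u *ₘ_) ⟩ ≈ ⟨ ruleₑ s ∣ f ∘ (e ⊕_) ⟩
        bridge e s u u≃v⟦e⟧ ul≤M with rule-lighter (triple s)
        ... | r₁< ∷ r₂< ∷ r₃< ∷ 1< ∷ [] =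
          ρ-cong (entry (⟦r₁ₑ⟧ s) r₁<) (entry (⟦r₂ₑ⟧ s) r₂<) (entry (⟦r₃ₑ⟧ s) r₃<) (entry ⟦𝟙⟧ 1<)
          where
          entry : ∀ {x m} → ⟦ x ⟧ ≃ m → W m ℕ.< W (lead (triple s)) → φ (u *ₘ m) ≈ f (e ⊕ x)
          entry {x} ⟦x⟧≃m m<l = resp (ℕP.<-≤-trans (W-*ₘ-monoʳ-< u m<l) ul≤M)
            (≃-trans (*ₘ-cong u≃v⟦e⟧ (≃-sym ⟦x⟧≃m)) (≃-trans (*ₘ-assoc v ⟦ e ⟧ ⟦ x ⟧) (*ₘ-cong (≃-refl {v}) (≃-sym (⟦⟧-⊕ e x)))))

        reducesₑ : ∀ s e → Small (e ⊕ leadₑ s) → f (e ⊕ leadₑ s) ≈ ⟨ ruleₑ s ∣ f ∘ (e ⊕_) ⟩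
        reducesₑ s e small = trans (resp lighter (⟦⊕leadₑ⟧ v e s))
          (trans (reduces (v *ₘ ⟦ e ⟧) (triple s) lighter′) (bridge e s (v *ₘ ⟦ e ⟧) ≃-refl (ℕP.<⇒≤ lighter′)))
          where
          lighter : W (v *ₘ ⟦ e ⊕ leadₑ s ⟧) ℕ.< W M
          lighter = P.subst₂ ℕ._<_ (P.sym (W-*ₘ v _)) (P.trans (P.sym (W-*ₘ v ⟦ apex ⟧)) (P.sym (W-resp M≃v·apex)))
            (ℕP.+-monoʳ-< (W v) (small-lighter (e ⊕ leadₑ s) small))
          lighter′ : W ((v *ₘ ⟦ e ⟧) *ₘ lead (triple s)) ℕ.< W M
          lighter′ = P.subst (ℕ._< W M) (W-resp (⟦⊕leadₑ⟧ v e s)) lighter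

        open CriticalPair f reducesₑ using (critical)

        via : ∀ s u → M ≃ u *ₘ lead (triple (fork s)) →
          ⟨ rule (triple (fork s)) ∣ φ ∘ (u *ₘ_) ⟩ ≈ ⟨ ruleₑ (fork s) ∣ f ∘ (third s ⊕_) ⟩
        via s u M≃ul = bridge (third s) (fork s) u u≃v·third (ℕP.≤-reflexive (P.sym (W-resp M≃ul)))
          where
          u≃v·third : u ≃ v *ₘ ⟦ third s ⟧
          u≃v·third = *ₘ-cancelʳ (lead (triple (fork s))) (≃-trans (≃-sym M≃ul) (≃-trans M≃v·apex
            (≃-trans (*ₘ-cong (≃-refl {v}) (apex-split s)) (⟦⊕leadₑ⟧ v (third s) (fork s)))))

    private
      leads-disjoint : ∀ {i j k i′ j′ k′} →
        (∀ {b b′} → b ≡ j ⊎ b ≡ k → b′ ≡ j′ ⊎ b′ ≡ k′ → ¬ (i′ ≡ i × b′ ≡ b)) →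
        Disjoint (varₘ i k *ₘ varₘ i j) (varₘ i′ k′ *ₘ varₘ i′ j′)
      leads-disjoint ≢ = disjoint-*ₘ
        (disjoint-sym (disjoint-*ₘ (varₘ-disjoint (≢ (inj₂ P.refl) (inj₂ P.refl))) (varₘ-disjoint (≢ (inj₁ P.refl) (inj₂ P.refl)))))
        (disjoint-sym (disjoint-*ₘ (varₘ-disjoint (≢ (inj₂ P.refl) (inj₁ P.refl))) (varₘ-disjoint (≢ (inj₁ P.refl) (inj₁ P.refl)))))

      joinable-same-apex : ∀ {i j k j′ k′} (i<j : i Fin.< j) (j<k : j Fin.< k) (i<j′ : i Fin.< j′) (j′<k′ : j′ Fin.< k′) u₁ u₂ →
        let t₁ = (i , j , k) , i<j , j<k ; t₂ = (i , j′ , k′) , i<j′ , j′<k′ in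
        M ≃ u₁ *ₘ lead t₁ → M ≃ u₂ *ₘ lead t₂ → Joinable u₁ t₁ u₂ t₂
      joinable-same-apex {i} {j} {k} {j′} {k′} i<j j<k i<j′ j′<k′ u₁ u₂ e₁ e₂
        with lead-entries i j k i<j j<k (≤ₘ-*ₘʳ u₁ e₁) | lead-entries i j′ k′ i<j′ j′<k′ (≤ₘ-*ₘʳ u₂ e₂)
           | j FinP.≟ j′ | k FinP.≟ k′ | j FinP.≟ k′ | k FinP.≟ j′
      ... | _ | _ | yes P.refl | yes P.refl | _ | _ = joinable-same u₁ u₂ ((i , j , k) , i<j , j<k) e₁ e₂
      ... | Mij , Mik | _ , Mik′ | yes P.refl | no k≢k′ | _ | _ with FinP.<-cmp k k′
      ...   | tri< k<k′ _ _ = joinable-apex i<j j<k k<k′ Mij Mik Mik′ ijk ijl u₁ u₂ e₁ e₂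
      ...   | tri≈ _ k≡k′ _ = ⊥-elim (k≢k′ k≡k′)
      ...   | tri> _ _ k′<k = joinable-apex i<j j′<k′ k′<k Mij Mik′ Mik ijl ijk u₁ u₂ e₁ e₂
      joinable-same-apex {i} {j} {k} {j′} i<j j<k i<j′ j′<k′ u₁ u₂ e₁ e₂
        | Mij , Mik | Mij′ , _ | no j≢j′ | yes P.refl | _ | _ with FinP.<-cmp j j′
      ...   | tri< j<j′ _ _ = joinable-apex i<j j<j′ j′<k′ Mij Mij′ Mik ijl ikl u₁ u₂ e₁ e₂
      ...   | tri≈ _ j≡j′ _ = ⊥-elim (j≢j′ j≡j′)
      ...   | tri> _ _ j′<j = joinable-apex i<j′ j′<j j<k Mij′ Mij Mik ikl ijl u₁ u₂ e₁ e₂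
      joinable-same-apex i<j j<k i<j′ j′<k′ u₁ u₂ e₁ e₂
        | Mij , Mik | Mij′ , _ | no _ | no _ | yes P.refl | _ = joinable-apex i<j′ j′<k′ j<k Mij′ Mij Mik ikl ijk u₁ u₂ e₁ e₂
      joinable-same-apex i<j j<k i<j′ j′<k′ u₁ u₂ e₁ e₂
        | Mij , Mik | _ , Mik′ | no _ | no _ | no _ | yes P.refl = joinable-apex i<j j<k j′<k′ Mij Mik Mik′ ijk ikl u₁ u₂ e₁ e₂
      joinable-same-apex {i} {j} {k} {j′} {k′} i<j j<k i<j′ j′<k′ u₁ u₂ e₁ e₂
        | _ | _ | no j≢j′ | no k≢k′ | no j≢k′ | no k≢j′ =
        joinable-disjoint u₁ ((i , j , k) , i<j , j<k) u₂ ((i , j′ , k′) , i<j′ , j′<k′) (leads-disjoint distinct) e₁ e₂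
        where
        distinct : ∀ {b b′} → b ≡ j ⊎ b ≡ k → b′ ≡ j′ ⊎ b′ ≡ k′ → ¬ (i ≡ i × b′ ≡ b)
        distinct (inj₁ P.refl) (inj₁ P.refl) (_ , P.refl) = j≢j′ P.refl
        distinct (inj₁ P.refl) (inj₂ P.refl) (_ , P.refl) = j≢k′ P.refl
        distinct (inj₂ P.refl) (inj₁ P.refl) (_ , P.refl) = k≢j′ P.refl
        distinct (inj₂ P.refl) (inj₂ P.refl) (_ , P.refl) = k≢k′ P.refl

    joinable : ∀ u₁ t₁ u₂ t₂ → M ≃ u₁ *ₘ lead t₁ → M ≃ u₂ *ₘ lead t₂ → Joinable u₁ t₁ u₂ t₂
    joinable u₁ ((i , j , k) , i<j , j<k) u₂ ((i′ , j′ , k′) , i′<j′ , j′<k′) e₁ e₂ with i FinP.≟ i′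
    ... | yes P.refl = joinable-same-apex i<j j<k i′<j′ j′<k′ u₁ u₂ e₁ e₂
    ... | no i≢i′ = joinable-disjoint u₁ ((i , j , k) , i<j , j<k) u₂ ((i′ , j′ , k′) , i′<j′ , j′<k′)
                      (leads-disjoint λ _ _ (i′≡i , _) → i≢i′ (P.sym i′≡i)) e₁ e₂

module NormalForm {c ℓ} (R : CommutativeRing c ℓ) (n : ℕ) (β α : CommutativeRing.Carrier R) where
  open CommutativeRing R
  open Poly R n
  open Pairing R
  open Monomials R n
  open Polynomials R n
  open Rewriting R n β α
  open import Relation.Binary.Reasoning.Setoid setoid

  cofactor : ∀ {m} → HasFork m → Mon
  cofactor {m} h = m ∸ₘ lead (forkTriple h)

  cofactor-split : ∀ {m} (h : HasFork m) → m ≃ cofactor h *ₘ lead (forkTriple h)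
  cofactor-split h = ∸ₘ-*ₘ (lead-≤ₘ h)

  reduct-lighter : ∀ {m} u t → m ≃ u *ₘ lead t → ∀ {r} → W r ℕ.< W (lead t) → W (u *ₘ r) ℕ.< W m
  reduct-lighter u t m≃ul {r} r<l = P.subst (W (u *ₘ r) ℕ.<_) (P.sym (W-resp m≃ul)) (W-*ₘ-monoʳ-< u r<l)

  fork-weight : ∀ {m} → HasFork m → 0 ℕ.< W m
  fork-weight h with rule-lighter (forkTriple h)
  ... | _ ∷ _ ∷ _ ∷ 1<l ∷ [] = ℕP.≤-<-trans z≤n (reduct-lighter (cofactor h) (forkTriple h) (cofactor-split h) 1<l)

  -- nf-with k m is the normal form as soon as W m ≤ k, since every reduction lowers the weight.
  nf-with : ℕ → Mon → Pol
  nf-step : ℕ → (m : Mon) → Dec (HasFork m) → Pol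
  nf-with zero m = monₚ m
  nf-with (suc k) m = nf-step k m (fork? m)
  nf-step k m (no _) = monₚ m
  nf-step k m (yes h) = bind (nf-with k) (cofactor h ·ₘ rule (forkTriple h))

  nf : Mon → Pol
  nf m = nf-with (W m) m

  nf-coeff : Mon → Mon → Carrier
  nf-coeff x m = coeff (nf m) x

  private
    weightless : ∀ {m} → W m ℕ.≤ 0 → ¬ HasFork m
    weightless m≤0 h = ℕP.<-irrefl P.refl (ℕP.<-≤-trans (fork-weight h) m≤0)

    nf-step-forkless : ∀ k m d → ¬ HasFork m → nf-step k m d ≡ monₚ m
    nf-step-forkless k m (no _) _ = P.refl
    nf-step-forkless k m (yes h) ¬h = ⊥-elim (¬h h)

    coeff-nf-step : ∀ k m (h : HasFork m) x →
      coeff (nf-step k m (yes h)) x ≈ ⟨ rule (forkTriple h) ∣ (λ r → coeff (nf-with k (cofactor h *ₘ r)) x) ⟩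
    coeff-nf-step k m h x = coeff-bind (nf-with k) (cofactor h ·ₘ rule (forkTriple h)) x

  nf-with-stable : ∀ k k′ m → W m ℕ.≤ k → W m ℕ.≤ k′ → nf-with k m ≈ₚ nf-with k′ m
  nf-step-stable : ∀ k k′ m d → W m ℕ.≤ suc k → W m ℕ.≤ suc k′ → nf-step k m d ≈ₚ nf-step k′ m d
  nf-with-stable zero zero m _ _ _ = refl
  nf-with-stable zero (suc k′) m m≤0 _ x =
    reflexive (P.cong (λ p → coeff p x) (P.sym (nf-step-forkless k′ m (fork? m) (weightless m≤0))))
  nf-with-stable (suc k) zero m _ m≤0 x =
    reflexive (P.cong (λ p → coeff p x) (nf-step-forkless k m (fork? m) (weightless m≤0)))
  nf-with-stable (suc k) (suc k′) m = nf-step-stable k k′ m (fork? m)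
  nf-step-stable k k′ m (no _) _ _ _ = refl
  nf-step-stable k k′ m (yes h) m≤k m≤k′ x = begin
    coeff (nf-step k m (yes h)) x                                ≈⟨ coeff-nf-step k m h x ⟩
    ⟨ rule t ∣ (λ r → coeff (nf-with k (u *ₘ r)) x) ⟩             ≈⟨ rule-cong t _ _ (λ r<l →
                                                                      nf-with-stable k k′ _ (fits r<l m≤k) (fits r<l m≤k′) x) ⟩
    ⟨ rule t ∣ (λ r → coeff (nf-with k′ (u *ₘ r)) x) ⟩            ≈⟨ coeff-nf-step k′ m h x ⟨
    coeff (nf-step k′ m (yes h)) x                               ∎
    where
    t : Triple
    t = forkTriple h
    u : Mon
    u = cofactor h
    fits : ∀ {r k} → W r ℕ.< W (lead t) → W m ℕ.≤ suc k → W (u *ₘ r) ℕ.≤ k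
    fits r<l m≤k = ℕP.≤-pred (ℕP.<-≤-trans (reduct-lighter u t (cofactor-split h) r<l) m≤k)

  nf-unfold : ∀ m → nf m ≈ₚ nf-step (W m) m (fork? m)
  nf-unfold m = nf-with-stable (W m) (suc (W m)) m ℕP.≤-refl (ℕP.n≤1+n _)

  nf-forkless : ∀ m → ¬ HasFork m → nf m ≈ₚ monₚ m
  nf-forkless m ¬h x = trans (nf-unfold m x) (reflexive (P.cong (λ p → coeff p x) (nf-step-forkless (W m) m (fork? m) ¬h)))

  nf-reduct : ∀ m → HasFork m →
    ∃ λ u → ∃ λ t → m ≃ u *ₘ lead t × (∀ x → nf-coeff x m ≈ ⟨ rule t ∣ nf-coeff x ∘ (u *ₘ_) ⟩)
  nf-reduct m h = by-cases (fork? m) (nf-unfold m)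
    where
    by-cases : (d : Dec (HasFork m)) → nf m ≈ₚ nf-step (W m) m d →
      ∃ λ u → ∃ λ t → m ≃ u *ₘ lead t × (∀ x → nf-coeff x m ≈ ⟨ rule t ∣ nf-coeff x ∘ (u *ₘ_) ⟩)
    by-cases (no ¬h) _ = ⊥-elim (¬h h)
    by-cases (yes h′) nf≈ = u , t , cofactor-split h′ , λ x → begin
      nf-coeff x m                                         ≈⟨ nf≈ x ⟩
      coeff (nf-step (W m) m (yes h′)) x                   ≈⟨ coeff-nf-step (W m) m h′ x ⟩
      ⟨ rule t ∣ (λ r → coeff (nf-with (W m) (u *ₘ r)) x) ⟩ ≈⟨ rule-cong t _ _ (λ {r} r<l →
                                                               nf-with-stable (W m) (W (u *ₘ r)) _ (ℕP.<⇒≤ (lighter r<l)) ℕP.≤-refl x) ⟩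
      ⟨ rule t ∣ nf-coeff x ∘ (u *ₘ_) ⟩                    ∎
      where
      t : Triple
      t = forkTriple h′
      u : Mon
      u = cofactor h′
      lighter : ∀ {r} → W r ℕ.< W (lead t) → W (u *ₘ r) ℕ.< W m
      lighter = reduct-lighter u t (cofactor-split h′)

  record Coherent (M : Mon) : Set ℓ where
    field
      resp : ∀ M′ → M ≃ M′ → nf M ≈ₚ nf M′
      reduces : ∀ u t → M ≃ u *ₘ lead t → ∀ x → nf-coeff x M ≈ ⟨ rule t ∣ nf-coeff x ∘ (u *ₘ_) ⟩

  private
    Below : Mon → Set ℓ
    Below M = ∀ m → W m ℕ.< W M → Coherent m

    reduces-step : ∀ M → Below M → ∀ u t → M ≃ u *ₘ lead t → ∀ x → nf-coeff x M ≈ ⟨ rule t ∣ nf-coeff x ∘ (u *ₘ_) ⟩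
    reduces-step M below u t M≃ul x with nf-reduct M (divisible⇒fork u t M≃ul)
    ... | u₀ , t₀ , M≃u₀l₀ , nf≈ = trans (nf≈ x) (joinable u₀ t₀ u t M≃u₀l₀ M≃ul)
      where
      open LocalConfluence (nf-coeff x) M
        (λ {m} m<M m≃m′ → Coherent.resp (below m m<M) _ m≃m′ x)
        (λ u t ul<M → Coherent.reduces (below (u *ₘ lead t) ul<M) u t ≃-refl x)

    resp-step : ∀ M → Below M → ∀ M′ → M ≃ M′ → nf M ≈ₚ nf M′
    resp-step M below M′ M≃M′ with fork? M
    ... | no ¬h = λ x → begin
      coeff (nf M) x     ≈⟨ nf-forkless M ¬h x ⟩
      coeff (monₚ M) x   ≈⟨ monₚ-resp M≃M′ x ⟩
      coeff (monₚ M′) x  ≈⟨ nf-forkless M′ (¬h ∘ fork-resp (≃-sym M≃M′)) x ⟨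
      coeff (nf M′) x    ∎
    ... | yes h with nf-reduct M h
    ...   | u , t , M≃ul , nf≈ = λ x → trans (nf≈ x) (sym (reduces-step M′ below′ u t (≃-trans (≃-sym M≃M′) M≃ul) x))
      where
      below′ : Below M′
      below′ m m<M′ = below m (P.subst (W m ℕ.<_) (P.sym (W-resp M≃M′)) m<M′)

  coherent : ∀ M → Coherent M
  coherent M = bounded (suc (W M)) M (ℕP.n<1+n (W M))
    where
    bounded : ∀ w M → W M ℕ.< w → Coherent M
    bounded (suc w) M M<w = record { resp = resp-step M below ; reduces = reduces-step M below }
      where
      below : Below M
      below m m<M = bounded w m (ℕP.<-≤-trans m<M (ℕP.≤-pred M<w))

  nf-coeff-resp : ∀ x → Respects (nf-coeff x)
  nf-coeff-resp x m≃m′ = Coherent.resp (coherent _) _ m≃m′ x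

  nf-coeff-reduces : ∀ x u t → Reduces (nf-coeff x) u t
  nf-coeff-reduces x u t = Coherent.reduces (coherent (u *ₘ lead t)) u t ≃-refl x

  reduct-All : ∀ {p} {P : Mon → Set p} {m} u t → m ≃ u *ₘ lead t →
    (∀ r → W (u *ₘ r) ℕ.< W m → P (u *ₘ r)) → All (P ∘ proj₂) (u ·ₘ rule t)
  reduct-All {m = m} u t m≃ul P-below with rule-lighter t
  ... | r₁< ∷ r₂< ∷ r₃< ∷ 1< ∷ [] =
    P-below _ (lighter r₁<) ∷ P-below _ (lighter r₂<) ∷ P-below _ (lighter r₃<) ∷ P-below _ (lighter 1<) ∷ []
    where
    lighter : ∀ {r} → W r ℕ.< W (lead t) → W (u *ₘ r) ℕ.< W m
    lighter = reduct-lighter u t m≃ul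

  nf-with-forkless : ∀ k m → W m ℕ.≤ k → All (Forkless ∘ proj₂) (nf-with k m)
  nf-with-forkless zero m m≤0 = weightless m≤0 ∷ []
  nf-with-forkless (suc k) m m≤k = by-cases (fork? m)
    where
    by-cases : (d : Dec (HasFork m)) → All (Forkless ∘ proj₂) (nf-step k m d)
    by-cases (no ¬h) = ¬h ∷ []
    by-cases (yes h) = All-bind (nf-with k) (cofactor h ·ₘ rule (forkTriple h))
      (reduct-All (cofactor h) (forkTriple h) (cofactor-split h) λ r r<m →
        nf-with-forkless k _ (ℕP.≤-pred (ℕP.<-≤-trans r<m m≤k)))

module Ideal {c ℓ} (R : CommutativeRing c ℓ) (n : ℕ) (β α : CommutativeRing.Carrier R) where
  open CommutativeRing R
  open Poly R n
  open Pairing R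
  open Monomials R n
  open Polynomials R n
  open Rewriting R n β α
  open NormalForm R n β α
  open IntegerCoefficientSolver R using (solve; _:=_; _:+_; _:*_; :-_; con)
  open import Algebra.Properties.Group +-group using (x≈y⇒x∙y⁻¹≈ε)
  open import Relation.Binary.Reasoning.Setoid setoid

  generated : List (Pol × Triple) → Pol
  generated fs = sumₚ (map (λ e → proj₁ e *ₚ gen β α (proj₂ e)) fs)

  scale-multipliers : Carrier → List (Pol × Triple) → List (Pol × Triple)
  scale-multipliers a = map λ e → scale a (proj₁ e) , proj₂ e

  private
    pairing-generated-++ : ∀ fs fs′ φ → ⟨ generated (fs ++ fs′) ∣ φ ⟩ ≈ ⟨ generated fs ∣ φ ⟩ + ⟨ generated fs′ ∣ φ ⟩
    pairing-generated-++ [] fs′ φ = sym (+-identityˡ _)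
    pairing-generated-++ ((f , t) ∷ fs) fs′ φ = begin
      ⟨ f *ₚ gen β α t ++ generated (fs ++ fs′) ∣ φ ⟩
        ≈⟨ pairing-++ (f *ₚ gen β α t) (generated (fs ++ fs′)) φ ⟩
      ⟨ f *ₚ gen β α t ∣ φ ⟩ + ⟨ generated (fs ++ fs′) ∣ φ ⟩                   ≈⟨ +-congˡ (pairing-generated-++ fs fs′ φ) ⟩
      ⟨ f *ₚ gen β α t ∣ φ ⟩ + (⟨ generated fs ∣ φ ⟩ + ⟨ generated fs′ ∣ φ ⟩)  ≈⟨ +-assoc _ _ _ ⟨
      (⟨ f *ₚ gen β α t ∣ φ ⟩ + ⟨ generated fs ∣ φ ⟩) + ⟨ generated fs′ ∣ φ ⟩
        ≈⟨ +-congʳ (pairing-++ (f *ₚ gen β α t) (generated fs) φ) ⟨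
      ⟨ f *ₚ gen β α t ++ generated fs ∣ φ ⟩ + ⟨ generated fs′ ∣ φ ⟩           ∎

    pairing-generated-scale : ∀ a fs φ →
      ⟨ generated (scale-multipliers a fs) ∣ φ ⟩ ≈ a * ⟨ generated fs ∣ φ ⟩
    pairing-generated-scale a [] φ = sym (zeroʳ a)
    pairing-generated-scale a ((f , t) ∷ fs) φ = begin
      ⟨ scale a f *ₚ g ++ generated (scale-multipliers a fs) ∣ φ ⟩   ≈⟨ pairing-++ (scale a f *ₚ g) _ φ ⟩
      ⟨ scale a f *ₚ g ∣ φ ⟩ + ⟨ generated (scale-multipliers a fs) ∣ φ ⟩ ≈⟨ +-cong scaled (pairing-generated-scale a fs φ) ⟩
      a * ⟨ f *ₚ g ∣ φ ⟩ + a * ⟨ generated fs ∣ φ ⟩                 ≈⟨ distribˡ a _ _ ⟨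
      a * (⟨ f *ₚ g ∣ φ ⟩ + ⟨ generated fs ∣ φ ⟩)                   ≈⟨ *-congˡ (pairing-++ (f *ₚ g) (generated fs) φ) ⟨
      a * ⟨ f *ₚ g ++ generated fs ∣ φ ⟩                             ∎
      where
      g : Pol
      g = gen β α t
      scaled : ⟨ scale a f *ₚ g ∣ φ ⟩ ≈ a * ⟨ f *ₚ g ∣ φ ⟩
      scaled = trans (pairing-*ₚ (scale a f) g φ)
        (trans (pairing-scale a f _) (*-congˡ (sym (pairing-*ₚ f g φ))))

  InJ-resp : ∀ {p q} → p ≈ₚ q → InJ β α q → InJ β α p
  InJ-resp p≈q (fs , q≈) = fs , λ y → trans (p≈q y) (q≈ y)

  InJ-++ : ∀ {p q} → InJ β α p → InJ β α q → InJ β α (p ++ q)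
  InJ-++ {p} {q} (fs , p≈) (fs′ , q≈) = fs ++ fs′ , λ y → begin
    coeff (p ++ q) y                                       ≈⟨ coeff-++ p q y ⟩
    coeff p y + coeff q y                                  ≈⟨ +-cong (p≈ y) (q≈ y) ⟩
    coeff (generated fs) y + coeff (generated fs′) y
      ≈⟨ +-cong (coeff≈pairing (generated fs) y) (coeff≈pairing (generated fs′) y) ⟩
    ⟨ generated fs ∣ δ y ⟩ + ⟨ generated fs′ ∣ δ y ⟩       ≈⟨ pairing-generated-++ fs fs′ (δ y) ⟨
    ⟨ generated (fs ++ fs′) ∣ δ y ⟩                        ≈⟨ coeff≈pairing (generated (fs ++ fs′)) y ⟨
    coeff (generated (fs ++ fs′)) y                        ∎

  InJ-scale : ∀ a {p} → InJ β α p → InJ β α (scale a p)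
  InJ-scale a {p} (fs , p≈) = fs′ , λ y → begin
    coeff (scale a p) y                                    ≈⟨ coeff≈pairing (scale a p) y ⟩
    ⟨ scale a p ∣ δ y ⟩                                    ≈⟨ pairing-scale a p (δ y) ⟩
    a * ⟨ p ∣ δ y ⟩
      ≈⟨ *-congˡ (trans (sym (coeff≈pairing p y)) (trans (p≈ y) (coeff≈pairing (generated fs) y))) ⟩
    a * ⟨ generated fs ∣ δ y ⟩                             ≈⟨ pairing-generated-scale a fs (δ y) ⟨
    ⟨ generated fs′ ∣ δ y ⟩                                ≈⟨ coeff≈pairing (generated fs′) y ⟨
    coeff (generated fs′) y                                ∎
    where
    fs′ : List (Pol × Triple)
    fs′ = scale-multipliers a fs

  InJ-bind : ∀ (F : Mon → Pol) p → All (λ e → InJ β α (F (proj₂ e))) p → InJ β α (bind F p)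
  InJ-bind F [] [] = [] , λ _ → refl
  InJ-bind F ((a , m) ∷ p) (Fm∈J ∷ Fp∈J) = InJ-++ {scale a (F m)} {bind F p} (InJ-scale a {F m} Fm∈J) (InJ-bind F p Fp∈J)

  InJ-reduct : ∀ u t → InJ β α (monₚ (u *ₘ lead t) -ₚ (u ·ₘ rule t))
  InJ-reduct u t = (((- 1# , u) ∷ []) , t) ∷ [] , coefficients
    where
    negate : ∀ d e → d - e ≈ (- 1# * (e - d) + 0#) + 0#
    negate = solve 2 (λ d e → d :+ :- e := (:- con (+ 1) :* (e :+ :- d) :+ con (+ 0)) :+ con (+ 0)) refl
    coefficients : (monₚ (u *ₘ lead t) -ₚ (u ·ₘ rule t)) ≈ₚ generated ((((- 1# , u) ∷ []) , t) ∷ [])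
    coefficients y = let ψ = δ y ∘ (u *ₘ_) in begin
      coeff (monₚ (u *ₘ lead t) -ₚ (u ·ₘ rule t)) y                ≈⟨ coeff--ₚ (monₚ (u *ₘ lead t)) (u ·ₘ rule t) y ⟩
      coeff (monₚ (u *ₘ lead t)) y - coeff (u ·ₘ rule t) y
        ≈⟨ +-cong (coeff-monₚ _ y) (-‿cong (coeff≈pairing (u ·ₘ rule t) y)) ⟩
      ψ (lead t) - ⟨ rule t ∣ ψ ⟩                                  ≈⟨ negate (ψ (lead t)) ⟨ rule t ∣ ψ ⟩ ⟩
      (- 1# * (⟨ rule t ∣ ψ ⟩ - ψ (lead t)) + 0#) + 0#
        ≈⟨ +-congʳ (+-congʳ (*-congˡ (pairing-gen (δ-resp y ∘ *ₘ-cong (≃-refl {u})) t))) ⟨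
      (- 1# * ⟨ gen β α t ∣ ψ ⟩ + 0#) + 0#                         ≈⟨ +-congʳ (pairing-*ₚ ((- 1# , u) ∷ []) (gen β α t) (δ y)) ⟨
      ⟨ ((- 1# , u) ∷ []) *ₚ gen β α t ∣ δ y ⟩ + 0#                ≈⟨ pairing-++ (((- 1# , u) ∷ []) *ₚ gen β α t) [] (δ y) ⟨
      ⟨ generated ((((- 1# , u) ∷ []) , t) ∷ []) ∣ δ y ⟩           ≈⟨ coeff≈pairing (generated ((((- 1# , u) ∷ []) , t) ∷ [])) y ⟨
      coeff (generated ((((- 1# , u) ∷ []) , t) ∷ [])) y            ∎

  InJ-0 : ∀ {p} → (∀ y → coeff p y ≈ 0#) → InJ β α p
  InJ-0 p≈0 = [] , p≈0

  InJ-self : ∀ p → InJ β α (p -ₚ p)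
  InJ-self p = InJ-0 {p -ₚ p} λ y → trans (coeff--ₚ p p y) (-‿inverseʳ _)

  InJ-nf-with : ∀ k m → W m ℕ.≤ k → InJ β α (monₚ m -ₚ nf-with k m)
  InJ-nf-with zero m _ = InJ-self (monₚ m)
  InJ-nf-with (suc k) m m≤k = by-cases (fork? m)
    where
    by-cases : (d : Dec (HasFork m)) → InJ β α (monₚ m -ₚ nf-step k m d)
    by-cases (no _) = InJ-self (monₚ m)
    by-cases (yes h) = InJ-resp {monₚ m -ₚ bind (nf-with k) red} {(monₚ (u *ₘ lead t) -ₚ red) ++ bind G red} telescope
      (InJ-++ {monₚ (u *ₘ lead t) -ₚ red} {bind G red} (InJ-reduct u t) (InJ-bind G red
        (reduct-All u t (cofactor-split h) λ r r<m → InJ-nf-with k _ (ℕP.≤-pred (ℕP.<-≤-trans r<m m≤k)))))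
      where
      u : Mon
      u = cofactor h
      t : Triple
      t = forkTriple h
      red : Pol
      red = u ·ₘ rule t
      G : Mon → Pol
      G r = monₚ r -ₚ nf-with k r
      split : ∀ a b c → a - c ≈ (a - b) + (b - c)
      split = solve 3 (λ a b c → a :+ :- c := (a :+ :- b) :+ (b :+ :- c)) refl
      telescope : (monₚ m -ₚ bind (nf-with k) red) ≈ₚ ((monₚ (u *ₘ lead t) -ₚ red) ++ bind G red)
      telescope y = begin
        coeff (monₚ m -ₚ bind (nf-with k) red) y                         ≈⟨ coeff--ₚ (monₚ m) (bind (nf-with k) red) y ⟩
        coeff (monₚ m) y - coeff (bind (nf-with k) red) y                ≈⟨ +-congʳ (monₚ-resp (cofactor-split h) y) ⟩
        coeff (monₚ (u *ₘ lead t)) y - coeff (bind (nf-with k) red) y    ≈⟨ split _ (coeff red y) _ ⟩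
        (coeff (monₚ (u *ₘ lead t)) y - coeff red y) + (coeff red y - coeff (bind (nf-with k) red) y)
          ≈⟨ +-cong (coeff--ₚ (monₚ (u *ₘ lead t)) red y)
                    (trans (sym (-ₚ-bind (nf-with k) red y)) (coeff--ₚ red (bind (nf-with k) red) y)) ⟨
        coeff (monₚ (u *ₘ lead t) -ₚ red) y + coeff (bind G red) y
          ≈⟨ coeff-++ (monₚ (u *ₘ lead t) -ₚ red) (bind G red) y ⟨
        coeff ((monₚ (u *ₘ lead t) -ₚ red) ++ bind G red) y                ∎

  nf-kills-J : ∀ fs x → ⟨ generated fs ∣ nf-coeff x ⟩ ≈ 0#
  nf-kills-J [] x = refl
  nf-kills-J ((f , t) ∷ fs) x = begin
    ⟨ f *ₚ gen β α t ++ generated fs ∣ φ ⟩                  ≈⟨ pairing-++ (f *ₚ gen β α t) (generated fs) φ ⟩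
    ⟨ f *ₚ gen β α t ∣ φ ⟩ + ⟨ generated fs ∣ φ ⟩           ≈⟨ +-congʳ (pairing-*ₚ f (gen β α t) φ) ⟩
    ⟨ f ∣ (λ u → ⟨ gen β α t ∣ φ ∘ (u *ₘ_) ⟩) ⟩ + ⟨ generated fs ∣ φ ⟩
      ≈⟨ +-cong (trans (pairing-cong f generator-vanishes) (pairing-0 f)) (nf-kills-J fs x) ⟩
    0# + 0#                                                 ≈⟨ +-identityʳ 0# ⟩
    0#                                                      ∎
    where
    φ : Mon → Carrier
    φ = nf-coeff x
    generator-vanishes : ∀ u → ⟨ gen β α t ∣ φ ∘ (u *ₘ_) ⟩ ≈ 0#
    generator-vanishes u = trans (pairing-gen (nf-coeff-resp x ∘ *ₘ-cong (≃-refl {u})) t)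
      (x≈y⇒x∙y⁻¹≈ε (sym (nf-coeff-reduces x u t)))

module Theorem {c ℓ} (R : CommutativeRing c ℓ) (n : ℕ) (β α : CommutativeRing.Carrier R) where
  open CommutativeRing R
  open Poly R n
  open Pairing R
  open Monomials R n
  open Polynomials R n
  open NormalForm R n β α
  open Ideal R n β α
  open import Relation.Binary.Reasoning.Setoid setoid

  forkless-span : ForklessSpan β α
  forkless-span p =
    bind nf p ,
    All-bind nf p (All.universal (λ e → nf-with-forkless (W (proj₂ e)) (proj₂ e) ℕP.≤-refl) p) ,
    InJ-resp {p -ₚ lincomb (bind nf p)} {bind (λ m → monₚ m -ₚ nf m) p} p-nf≈
      (InJ-bind (λ m → monₚ m -ₚ nf m) p (All.universal (λ e → InJ-nf-with (W (proj₂ e)) (proj₂ e) ℕP.≤-refl) p))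
    where
    p-nf≈ : (p -ₚ lincomb (bind nf p)) ≈ₚ bind (λ m → monₚ m -ₚ nf m) p
    p-nf≈ y = begin
      coeff (p -ₚ lincomb (bind nf p)) y        ≈⟨ coeff--ₚ p (lincomb (bind nf p)) y ⟩
      coeff p y - coeff (lincomb (bind nf p)) y ≈⟨ +-congˡ (-‿cong (coeff-lincomb (bind nf p) y)) ⟩
      coeff p y - coeff (bind nf p) y           ≈⟨ coeff--ₚ p (bind nf p) y ⟨
      coeff (p -ₚ bind nf p) y                  ≈⟨ -ₚ-bind nf p y ⟩
      coeff (bind (λ m → monₚ m -ₚ nf m) p) y   ∎

  forkless-independent : ForklessIndependent β α
  forkless-independent ts forkless (fs , ts≈) y = begin
    coeff ts y                       ≈⟨ coeff≈pairing ts y ⟩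
    ⟨ ts ∣ δ y ⟩                     ≈⟨ pairing-congᴬ (All.map (λ {t} ¬fork →
                                          sym (trans (nf-forkless (proj₂ t) ¬fork y) (coeff-monₚ (proj₂ t) y))) forkless) ⟩
    ⟨ ts ∣ nf-coeff y ⟩              ≈⟨ pairing-lincomb ts (nf-coeff y) ⟨
    ⟨ lincomb ts ∣ nf-coeff y ⟩      ≈⟨ pairing-resp (nf-coeff-resp y) {lincomb ts} {generated fs} ts≈ ⟩
    ⟨ generated fs ∣ nf-coeff y ⟩    ≈⟨ nf-kills-J fs y ⟩
    0#                               ∎

proposition4p4 : ∀ {c ℓ : Level} (R : CommutativeRing c ℓ)
    (β α : CommutativeRing.Carrier R) (n : ℕ) → 1 ≤ n →
    Poly.ForklessBasis R n β α
proposition4p4 R β α n _ = forkless-span , forkless-independent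
  where open Theorem R n β α
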